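{- For $k\geq 0$ let $R_k(x)=\sum_{n\geq0} r_{n,k}x^n$, where $r_{n,k}$ is the number of $132$-avoiding Dumont permutations of length $n$ having exactly $k$ right-to-left maxima. Then $R_k(x)=x^{2k-2}C(x^2)^{k-1}$ for all $k\geq 2$, and $R_k(x)=x^kC(x^2)^k$ for $k=0,1$.
   Context: A permutation $\pi=\pi_1\cdots\pi_n\in S_n$ is a Dumont permutation (of the first kind) if every even entry $\pi_i$ is followed by a smaller entry ($i<n$ and $\pi_{i+1}<\pi_i$) and every odd entry $\pi_i$ is either last ($i=n$) or followed by a larger entry; the empty permutation is a Dumont permutation. $\pi$ avoids $132$ if there are no $i<j<l$ with $\pi_i<\pi_l<\pi_j$. An entry $\pi_i$ is a right-to-left maximum if $\pi_i>\pi_j$ for all $j>i$. $C(x)=\sum_{m\geq0}\frac{1}{m+1}\binom{2m}{m}x^m=\frac{1-\sqrt{1-4x}}{2x}$. -}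

module Defs where

open import Data.Nat using (ℕ; zero; suc; _+_; _*_; _∸_; _/_; _%_; _<ᵇ_; _≤ᵇ_; _≡ᵇ_)
open import Data.Nat.Combinatorics using (_C_)
open import Data.Bool using (Bool; true; false; _∧_; _∨_; not; if_then_else_)
open import Data.List using (List; []; _∷_; length; filter; concatMap; map)
open import Data.Bool.ListAction using (any; all)
open import Relation.Nullary.Decidable using (Dec; yes; no)
open import Data.Bool.Properties using (T?)
open import Data.List.Base using (applyUpTo)

insertions : ℕ → List ℕ → List (List ℕ)
insertions x [] = (x ∷ []) ∷ []
insertions x (y ∷ ys) = (x ∷ y ∷ ys) ∷ map (y ∷_) (insertions x ys)

perms : List ℕ → List (List ℕ)
perms [] = [] ∷ []
perms (x ∷ xs) = concatMap (insertions x) (perms xs)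

oneTo : ℕ → List ℕ
oneTo n = applyUpTo suc n

Sym : ℕ → List (List ℕ)
Sym n = perms (oneTo n)

isEven : ℕ → Bool
isEven n = n % 2 ≡ᵇ 0

isDumont : List ℕ → Bool
isDumont [] = true
isDumont (a ∷ []) = not (isEven a)
isDumont (a ∷ b ∷ rest) =
  (if isEven a then b <ᵇ a else a <ᵇ b) ∧ isDumont (b ∷ rest)

has21above : ℕ → List ℕ → Bool
has21above a [] = false
has21above a (b ∷ xs) = any (λ c → (a <ᵇ c) ∧ (c <ᵇ b)) xs ∨ has21above a xs

contains132 : List ℕ → Bool
contains132 [] = false
contains132 (a ∷ xs) = has21above a xs ∨ contains132 xs

avoids132 : List ℕ → Bool
avoids132 π = not (contains132 π)

rlMaxCount : List ℕ → ℕ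
rlMaxCount [] = 0
rlMaxCount (a ∷ xs) = (if all (_<ᵇ a) xs then 1 else 0) + rlMaxCount xs

good : ℕ → List ℕ → Bool
good k π = isDumont π ∧ avoids132 π ∧ (rlMaxCount π ≡ᵇ k)

r : ℕ → ℕ → ℕ
r n k = length (filter (λ π → T? (good k π)) (Sym n))

-- Formal power series over ℕ, represented by their coefficient sequences

Series : Set
Series = ℕ → ℕ

sumTo : ℕ → (ℕ → ℕ) → ℕ
sumTo zero h = h 0
sumTo (suc n) h = sumTo n h + h (suc n)

_·_ : Series → Series → Series
(f · g) n = sumTo n (λ i → f i * g (n ∸ i))

one : Series
one zero = 1
one (suc n) = 0

_^^_ : Series → ℕ → Series
f ^^ zero = one
f ^^ suc m = f · (f ^^ m)

xPow· : ℕ → Series → Series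
xPow· k f n = if k ≤ᵇ n then f (n ∸ k) else 0

subSq : Series → Series
subSq f n = if isEven n then f (n / 2) else 0

-- C(x) = Σ_m (1/(m+1)) binom(2m,m) x^m   (the division is exact)
Cat : Series
Cat m = ((2 * m) C m) / suc m

R : ℕ → Series
R k n = r n k

-- A 132-avoiding permutation of 1, …, n + 1 splits at its maximum as (α + b) (n + 1) β:
-- every entry before the maximum exceeds every entry after it, so β is a
-- 132-avoiding permutation of 1, …, b and α one of 1, …, n − b, and conversely
-- every such gluing avoids 132. It is Dumont exactly when α and β are, n + 1 is
-- odd iff β is empty, and b is even unless α is empty (otherwise the least entry
-- b + 1 of the prefix is even but followed by a larger entry). Its right-to-left
-- maxima are n + 1 and those of β. Hence the numbers of such permutations of
-- lengths 2m and 2m + 1 both satisfy the Catalan recurrence, so equal C_m (which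
-- is matched with the binomial formula through ballot numbers), and r(n, k)
-- satisfies a convolution recurrence giving R₀ = 1, R₁ = x C(x²), R₂ = x² C(x²)
-- and R_{k+1} = x² C(x²) R_k for k ≥ 2.

module Submission where

open import Defs
open import Data.Nat
open import Data.Nat.Properties
open import Data.Nat.Combinatorics using (_C_; nCk≡nC[n∸k]; nC1≡n) renaming (nCk+nC[k+1]≡[n+1]C[k+1] to pascal)
open import Data.Nat.DivMod using (m*n/n≡m)
open import Data.Nat.ListAction using (sum)
open import Data.Nat.ListAction.Properties using (sum-++)
open import Data.Nat.Tactic.RingSolver using (solve-∀)
open import Data.Bool using (Bool; true; false; _∧_; _∨_; not; T; if_then_else_)
open import Data.Bool.Properties
  using ( T?; T-≡; T-not-≡; T-∧; not-involutive; ∧-assoc; ∨-assoc; ∧-zeroʳ; ∨-zeroʳ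
        ; ∧-conicalˡ; ∧-conicalʳ; ∨-conicalˡ; ∨-conicalʳ)
open import Data.Bool.ListAction using (any; all)
open import Data.List using (List; []; _∷_; _++_; [_]; map; concatMap; filter; length; applyUpTo; upTo)
import Data.List.Properties as List
open import Data.List.Relation.Unary.Any as Any using (here; there)
open import Data.List.Relation.Unary.All as All using (All; []; _∷_)
import Data.List.Relation.Unary.All.Properties as All
open import Data.List.Relation.Unary.Unique.Propositional using (Unique; []; _∷_)
import Data.List.Relation.Unary.Unique.Propositional.Properties as Unique
open import Data.List.Membership.Propositional using (_∈_; _∉_; find; lose)
open import Data.List.Membership.Propositional.Properties
  using ( ∈-map⁺; ∈-map⁻; ∈-concatMap⁺; ∈-concatMap⁻; ∈-++⁺ˡ; ∈-++⁺ʳ; ∈-++⁻; ∈-∃++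
        ; ∈-applyUpTo⁺; ∈-applyUpTo⁻; ∈-filter⁺; ∈-filter⁻)
open import Data.List.Membership.Propositional.Properties.WithK using (unique∧set⇒bag)
open import Data.List.Relation.Binary.BagAndSetEquality using (∼bag⇒↭)
open import Data.List.Relation.Binary.Permutation.Propositional
  using (_↭_; ↭-refl; ↭-sym; ↭-trans; ↭-prep; ↭⇒↭ₛ; module PermutationReasoning)
import Data.List.Relation.Binary.Permutation.Propositional.Properties as ↭
open import Data.Product using (∃; ∃₂; _×_; _,_; proj₁; proj₂)
open import Data.Sum using (_⊎_; inj₁; inj₂; map₁)
open import Data.Empty using (⊥; ⊥-elim)
open import Function.Bundles using (_⇔_; mk⇔; Equivalence)
open import Relation.Nullary using (¬_; Dec)
open import Relation.Binary.Definitions using (tri<; tri≈; tri>)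
open import Relation.Binary.PropositionalEquality hiding ([_])
open import Data.List.Relation.Binary.Permutation.Setoid.Properties (setoid ℕ) using (Unique-resp-↭)
open ↭ using (∈-resp-↭; ↭-length; filter-↭; shift; drop-mid; ↭-empty-inv)
open Equivalence using (to; from)
open ≡-Reasoning

-- Catalan numbers through ballot numbers

C-absorption : ∀ n k → suc k * (n C suc k) + k * (n C k) ≡ n * (n C k)
C-absorption zero    zero    = refl
C-absorption zero    (suc k) = cong₂ _+_ (*-zeroʳ (suc (suc k))) (*-zeroʳ (suc k))
C-absorption (suc n) zero    = begin
  1 * (suc n C 1) + 0 ≡⟨ trans (+-identityʳ _) (*-identityˡ _) ⟩
  suc n C 1           ≡⟨ nC1≡n (suc n) ⟩
  suc n               ≡⟨ *-identityʳ (suc n) ⟨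
  suc n * 1           ∎
C-absorption (suc n) (suc k) = begin
  suc (suc k) * (suc n C suc (suc k)) + suc k * (suc n C suc k)
    ≡⟨ cong₂ (λ x y → suc (suc k) * x + suc k * y) (pascal n (suc k)) (pascal n k) ⟨
  suc (suc k) * (n C suc k + n C suc (suc k)) + suc k * (n C k + n C suc k)
    ≡⟨ regroup k (n C k) (n C suc k) (n C suc (suc k)) ⟩
  (suc (suc k) * (n C suc (suc k)) + suc k * (n C suc k)) + n C suc k
    + ((suc k * (n C suc k) + k * (n C k)) + n C k)
    ≡⟨ cong₂ (λ x y → x + n C suc k + (y + n C k)) (C-absorption n (suc k)) (C-absorption n k) ⟩
  n * (n C suc k) + n C suc k + (n * (n C k) + n C k)
    ≡⟨ collect n (n C k) (n C suc k) ⟩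
  suc n * (n C k + n C suc k)
    ≡⟨ cong (suc n *_) (pascal n k) ⟩
  suc n * (suc n C suc k) ∎
  where
  regroup : ∀ k x y z → suc (suc k) * (y + z) + suc k * (x + y)
                      ≡ (suc (suc k) * z + suc k * y) + y + ((suc k * y + k * x) + x)
  regroup = solve-∀
  collect : ∀ n x y → n * y + y + (n * x + x) ≡ suc n * (x + y)
  collect = solve-∀

-- ballot d h counts lattice paths with d up-steps that start at height h,
-- end at height 0 and never go below 0 (split by the first step).
ballot : ℕ → ℕ → ℕ
ballot zero    h       = 1
ballot (suc d) zero    = ballot d 1
ballot (suc d) (suc h) = ballot (suc d) h + ballot d (suc (suc h))

ballot-one : ∀ h → ballot 1 h ≡ suc h
ballot-one zero    = refl
ballot-one (suc h) = trans (cong (_+ 1) (ballot-one h)) (+-comm (suc h) 1)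

C-middle : ∀ d → (1 + 2 * d) C suc d ≡ (1 + 2 * d) C d
C-middle d = begin
  (1 + 2 * d) C suc d               ≡⟨ nCk≡nC[n∸k] (s≤s (m≤n*m d 2)) ⟩
  (1 + 2 * d) C (2 * d ∸ d)         ≡⟨ cong ((1 + 2 * d) C_) (trans (cong (_∸ d) (2*d≡d+d d)) (m+n∸m≡n d d)) ⟩
  (1 + 2 * d) C d                   ∎
  where
  2*d≡d+d : ∀ d → 2 * d ≡ d + d
  2*d≡d+d = solve-∀

-- The ballot theorem ballot (d + 1) h = C(n, d + 1) − C(n, d), n = h + 2(d + 1),
-- with the subtraction moved across.
ballot-binomial : ∀ d h n → n ≡ h + 2 * suc d → ballot (suc d) h + n C d ≡ n C suc d
ballot-binomial zero h n refl = begin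
  ballot 1 h + 1   ≡⟨ cong (_+ 1) (ballot-one h) ⟩
  suc h + 1        ≡⟨ +-comm (suc h) 1 ⟩
  suc (suc h)      ≡⟨ +-comm 2 h ⟩
  h + 2            ≡⟨ nC1≡n (h + 2) ⟨
  (h + 2) C 1      ∎
ballot-binomial (suc d) zero (suc n) eq = begin
  ballot (suc d) 1 + suc n C suc d           ≡⟨ cong (ballot (suc d) 1 +_) (pascal n d) ⟨
  ballot (suc d) 1 + (n C d + n C suc d)     ≡⟨ +-assoc (ballot (suc d) 1) _ _ ⟨
  (ballot (suc d) 1 + n C d) + n C suc d     ≡⟨ cong (_+ n C suc d) (ballot-binomial d 1 n n≡) ⟩
  n C suc d + n C suc d                      ≡⟨ cong (n C suc d +_) middle ⟨
  n C suc d + n C suc (suc d)                ≡⟨ pascal n (suc d) ⟩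
  suc n C suc (suc d)                        ∎
  where
  n≡ : n ≡ 1 + 2 * suc d
  n≡ = suc-injective (trans eq (arith d))
    where
    arith : ∀ d → 2 * suc (suc d) ≡ suc (1 + 2 * suc d)
    arith = solve-∀
  middle : n C suc (suc d) ≡ n C suc d
  middle = subst (λ n → n C suc (suc d) ≡ n C suc d) (sym n≡) (C-middle (suc d))
ballot-binomial (suc d) (suc h) (suc n) eq = begin
  (ballot (suc (suc d)) h + ballot (suc d) (suc (suc h))) + suc n C suc d
    ≡⟨ cong (ballot (suc (suc d)) h + ballot (suc d) (suc (suc h)) +_) (pascal n d) ⟨
  (ballot (suc (suc d)) h + ballot (suc d) (suc (suc h))) + (n C d + n C suc d)
    ≡⟨ interchange (ballot (suc (suc d)) h) (ballot (suc d) (suc (suc h))) (n C d) (n C suc d) ⟩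
  (ballot (suc (suc d)) h + n C suc d) + (ballot (suc d) (suc (suc h)) + n C d)
    ≡⟨ cong₂ _+_ (ballot-binomial (suc d) h n n≡) (ballot-binomial d (suc (suc h)) n (trans n≡ (arith d h))) ⟩
  n C suc (suc d) + n C suc d
    ≡⟨ +-comm (n C suc (suc d)) (n C suc d) ⟩
  n C suc d + n C suc (suc d)
    ≡⟨ pascal n (suc d) ⟩
  suc n C suc (suc d) ∎
  where
  n≡ : n ≡ h + 2 * suc (suc d)
  n≡ = suc-injective eq
  arith : ∀ d h → h + 2 * suc (suc d) ≡ suc (suc h) + 2 * suc d
  arith = solve-∀
  interchange : ∀ a b c d → (a + b) + (c + d) ≡ (a + d) + (b + c)
  interchange = solve-∀

Cat≡ballot : ∀ m → Cat m ≡ ballot m 0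
Cat≡ballot zero    = refl
Cat≡ballot (suc k) = begin
  ((2 * suc k) C suc k) / suc (suc k)      ≡⟨ cong (_/ suc (suc k)) central ⟩
  ballot (suc k) 0 * suc (suc k) / suc (suc k) ≡⟨ m*n/n≡m (ballot (suc k) 0) (suc (suc k)) ⟩
  ballot (suc k) 0                         ∎
  where
  n = 2 * suc k
  balance : suc k * (n C suc k) ≡ suc (suc k) * (n C k)
  balance = +-cancelʳ-≡ (k * (n C k)) _ _ (trans (C-absorption n k) (arith k (n C k)))
    where
    arith : ∀ k x → 2 * suc k * x ≡ suc (suc k) * x + k * x
    arith = solve-∀
  central : n C suc k ≡ ballot (suc k) 0 * suc (suc k)
  central = +-cancelʳ-≡ (suc (suc k) * (n C k)) _ _ (begin
    n C suc k + suc (suc k) * (n C k)   ≡⟨ cong (n C suc k +_) balance ⟨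
    n C suc k + suc k * (n C suc k)     ≡⟨⟩
    suc (suc k) * (n C suc k)           ≡⟨ cong (suc (suc k) *_) (ballot-binomial k 0 n refl) ⟨
    suc (suc k) * (ballot (suc k) 0 + n C k) ≡⟨ *-distribˡ-+ (suc (suc k)) (ballot (suc k) 0) (n C k) ⟩
    suc (suc k) * ballot (suc k) 0 + suc (suc k) * (n C k)
      ≡⟨ cong (_+ suc (suc k) * (n C k)) (*-comm (suc (suc k)) (ballot (suc k) 0)) ⟩
    ballot (suc k) 0 * suc (suc k) + suc (suc k) * (n C k) ∎)

sumTo-cong : ∀ n {f g : ℕ → ℕ} → (∀ i → i ≤ n → f i ≡ g i) → sumTo n f ≡ sumTo n g
sumTo-cong zero    f≗g = f≗g 0 z≤n
sumTo-cong (suc n) f≗g = cong₂ _+_ (sumTo-cong n (λ i i≤n → f≗g i (m≤n⇒m≤1+n i≤n))) (f≗g (suc n) ≤-refl)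

sumTo-+ : ∀ n (f g : ℕ → ℕ) → sumTo n (λ i → f i + g i) ≡ sumTo n f + sumTo n g
sumTo-+ zero    f g = refl
sumTo-+ (suc n) f g = begin
  sumTo n (λ i → f i + g i) + (f (suc n) + g (suc n))  ≡⟨ cong (_+ (f (suc n) + g (suc n))) (sumTo-+ n f g) ⟩
  sumTo n f + sumTo n g + (f (suc n) + g (suc n))      ≡⟨ interchange (sumTo n f) (sumTo n g) (f (suc n)) (g (suc n)) ⟩
  sumTo n f + f (suc n) + (sumTo n g + g (suc n))      ∎
  where
  interchange : ∀ a b c d → a + b + (c + d) ≡ a + c + (b + d)
  interchange = solve-∀

sumTo-suc : ∀ n (f : ℕ → ℕ) → sumTo (suc n) f ≡ f 0 + sumTo n (λ i → f (suc i))
sumTo-suc zero    f = refl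
sumTo-suc (suc n) f = trans (cong (_+ f (suc (suc n))) (sumTo-suc n f)) (+-assoc (f 0) _ _)

ballot-convolution : ∀ d h → ballot d (suc h) ≡ sumTo d (λ i → ballot i h * ballot (d ∸ i) 0)
ballot-convolution zero    h       = refl
ballot-convolution (suc d) zero    = begin
  ballot (suc d) 0 + ballot d 2
    ≡⟨ cong₂ _+_ (sym (+-identityʳ (ballot (suc d) 0))) (ballot-convolution d 1) ⟩
  1 * ballot (suc d) 0 + sumTo d (λ i → ballot (suc i) 0 * ballot (d ∸ i) 0)
    ≡⟨ sumTo-suc d (λ i → ballot i 0 * ballot (suc d ∸ i) 0) ⟨
  sumTo (suc d) (λ i → ballot i 0 * ballot (suc d ∸ i) 0) ∎
ballot-convolution (suc d) (suc h) = begin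
  ballot (suc d) (suc h) + ballot d (suc (suc (suc h)))
    ≡⟨ cong₂ _+_ (ballot-convolution (suc d) h) (ballot-convolution d (suc (suc h))) ⟩
  sumTo (suc d) (λ i → ballot i h * c (suc d ∸ i)) + sumTo d v
    ≡⟨ cong (_+ sumTo d v) (sumTo-suc d (λ i → ballot i h * c (suc d ∸ i))) ⟩
  (1 * c (suc d) + sumTo d u) + sumTo d v
    ≡⟨ +-assoc (1 * c (suc d)) (sumTo d u) (sumTo d v) ⟩
  1 * c (suc d) + (sumTo d u + sumTo d v)
    ≡⟨ cong (1 * c (suc d) +_) (sumTo-+ d u v) ⟨
  1 * c (suc d) + sumTo d (λ i → u i + v i)
    ≡⟨ cong (1 * c (suc d) +_) (sumTo-cong d (λ i _ → *-distribʳ-+ (c (d ∸ i)) (ballot (suc i) h) (ballot i (suc (suc h))))) ⟨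
  1 * c (suc d) + sumTo d (λ i → ballot (suc i) (suc h) * c (d ∸ i))
    ≡⟨ sumTo-suc d (λ i → ballot i (suc h) * c (suc d ∸ i)) ⟨
  sumTo (suc d) (λ i → ballot i (suc h) * c (suc d ∸ i)) ∎
  where
  c u v : ℕ → ℕ
  c n = ballot n 0
  u i = ballot (suc i) h * c (d ∸ i)
  v i = ballot i (suc (suc h)) * c (d ∸ i)

Cat-convolution : ∀ m → (Cat · Cat) m ≡ Cat (suc m)
Cat-convolution m = begin
  sumTo m (λ i → Cat i * Cat (m ∸ i))               ≡⟨ sumTo-cong m (λ i _ → cong₂ _*_ (Cat≡ballot i) (Cat≡ballot (m ∸ i))) ⟩
  sumTo m (λ i → ballot i 0 * ballot (m ∸ i) 0)     ≡⟨ ballot-convolution m 0 ⟨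
  ballot m 1                                        ≡⟨ Cat≡ballot (suc m) ⟨
  Cat (suc m)                                       ∎

Catalan-unique : ∀ (f : Series) → f 0 ≡ 1 → (∀ m → f (suc m) ≡ (f · f) m) → ∀ m → f m ≡ Cat m
Catalan-unique f f0 f-rec m = up-to m m ≤-refl
  where
  up-to : ∀ m j → j ≤ m → f j ≡ Cat j
  up-to m       zero    _         = f0
  up-to (suc m) (suc j) (s≤s j≤m) = begin
    f (suc j)       ≡⟨ f-rec j ⟩
    (f · f) j       ≡⟨ sumTo-cong j (λ i i≤j → cong₂ _*_ (up-to m i (≤-trans i≤j j≤m))
                                                        (up-to m (j ∸ i) (≤-trans (m∸n≤m j i) j≤m))) ⟩
    (Cat · Cat) j   ≡⟨ Cat-convolution j ⟩
    Cat (suc j)     ∎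

-- Parity and power series

false≢true : false ≢ true
false≢true ()

isEven-suc : ∀ n → isEven (suc n) ≡ not (isEven n)
isEven-suc zero          = refl
isEven-suc (suc zero)    = refl
isEven-suc (suc (suc n)) = isEven-suc n

isEven-double : ∀ m → isEven (m + m) ≡ true
isEven-double zero    = refl
isEven-double (suc m) = trans (cong (λ t → isEven (suc t)) (+-suc m m)) (isEven-double m)

isEven-suc-double : ∀ m → isEven (suc (m + m)) ≡ false
isEven-suc-double m = trans (isEven-suc (m + m)) (cong not (isEven-double m))

isEven-+ : ∀ b a → isEven b ≡ true → isEven (b + a) ≡ isEven a
isEven-+ zero          a _  = refl
isEven-+ (suc (suc b)) a ev = isEven-+ b a ev

data EvenOrOdd : ℕ → Set where
  even : ∀ m → EvenOrOdd (m + m)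
  odd  : ∀ m → EvenOrOdd (suc (m + m))

evenOrOdd : ∀ n → EvenOrOdd n
evenOrOdd zero = even 0
evenOrOdd (suc n) with evenOrOdd n
... | even m = odd m
... | odd m  = subst EvenOrOdd (cong suc (+-suc m m)) (even (suc m))

isEven⇒double : ∀ {b} → isEven b ≡ true → ∃ λ j → b ≡ j + j
isEven⇒double {b} ev with evenOrOdd b
... | even j = j , refl
... | odd j  = ⊥-elim (false≢true (trans (sym (isEven-suc-double j)) ev))

double-suc : ∀ m → suc m + suc m ≡ suc (suc (m + m))
double-suc m = cong suc (+-suc m m)

sum-applyUpTo-+ : ∀ m h → sum (applyUpTo h m) + h m ≡ sumTo m h
sum-applyUpTo-+ zero    h = refl
sum-applyUpTo-+ (suc m) h = cong (_+ h (suc m)) (begin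
  sum (applyUpTo h (suc m))            ≡⟨ cong sum (List.applyUpTo-∷ʳ h m) ⟨
  sum (applyUpTo h m ++ [ h m ])       ≡⟨ sum-++ (applyUpTo h m) [ h m ] ⟩
  sum (applyUpTo h m) + (h m + 0)      ≡⟨ cong (sum (applyUpTo h m) +_) (+-identityʳ (h m)) ⟩
  sum (applyUpTo h m) + h m            ≡⟨ sum-applyUpTo-+ m h ⟩
  sumTo m h                            ∎)

·-zeroʳ : ∀ f m → (f · (λ _ → 0)) m ≡ 0
·-zeroʳ f zero    = *-zeroʳ (f 0)
·-zeroʳ f (suc m) = cong₂ _+_ (·-zeroʳ f m) (*-zeroʳ (f (suc m)))

·-identityʳ : ∀ f m → (f · one) m ≡ f m
·-identityʳ f zero    = *-identityʳ (f 0)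
·-identityʳ f (suc m) = begin
  sumTo m (λ i → f i * one (suc m ∸ i)) + f (suc m) * one (m ∸ m)
    ≡⟨ cong₂ _+_ (sumTo-cong m (λ i i≤m → cong (λ t → f i * one t) (+-∸-assoc 1 i≤m)))
                 (cong (λ t → f (suc m) * one t) (n∸n≡0 m)) ⟩
  (f · (λ _ → 0)) m + f (suc m) * 1
    ≡⟨ cong₂ _+_ (·-zeroʳ f m) (*-identityʳ (f (suc m))) ⟩
  f (suc m) ∎

xPow·-suc : ∀ s f n → xPow· (suc s) f (suc n) ≡ xPow· s f n
xPow·-suc zero    f n = refl
xPow·-suc (suc s) f n = refl

·-xPow· : ∀ s g f m → (g · xPow· s f) m ≡ xPow· s (g · f) m
·-xPow· zero    g f m       = refl
·-xPow· (suc s) g f zero    = *-zeroʳ (g 0)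
·-xPow· (suc s) g f (suc m) = begin
  sumTo m (λ i → g i * xPow· (suc s) f (suc m ∸ i)) + g (suc m) * xPow· (suc s) f (m ∸ m)
    ≡⟨ cong₂ _+_ (sumTo-cong m (λ i i≤m → cong (λ t → g i * xPow· (suc s) f t) (+-∸-assoc 1 i≤m)))
                 (cong (λ t → g (suc m) * xPow· (suc s) f t) (n∸n≡0 m)) ⟩
  sumTo m (λ i → g i * xPow· (suc s) f (suc (m ∸ i))) + g (suc m) * 0
    ≡⟨ cong₂ _+_ (sumTo-cong m (λ i _ → cong (g i *_) (xPow·-suc s f (m ∸ i)))) (*-zeroʳ (g (suc m))) ⟩
  (g · xPow· s f) m + 0
    ≡⟨ +-identityʳ _ ⟩
  (g · xPow· s f) m
    ≡⟨ ·-xPow· s g f m ⟩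
  xPow· s (g · f) m
    ≡⟨ xPow·-suc s (g · f) m ⟨
  xPow· (suc s) (g · f) (suc m) ∎

subSq-double : ∀ f m → subSq f (m + m) ≡ f m
subSq-double f m rewrite isEven-double m = cong f (trans (cong (_/ 2) (+-*-double m)) (m*n/n≡m m 2))
  where
  +-*-double : ∀ m → m + m ≡ m * 2
  +-*-double m = trans (cong (m +_) (sym (+-identityʳ m))) (*-comm 2 m)

subSq-suc-double : ∀ f m → subSq f (suc (m + m)) ≡ 0
subSq-suc-double f m rewrite isEven-suc-double m = refl

xPow·-subSq-double : ∀ t f m → xPow· (t + t) (subSq f) (m + m) ≡ xPow· t f m
xPow·-subSq-double zero    f m       = subSq-double f m
xPow·-subSq-double (suc t) f zero    = refl
xPow·-subSq-double (suc t) f (suc m) = begin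
  xPow· (suc t + suc t) (subSq f) (suc m + suc m)
    ≡⟨ cong₂ (λ x y → xPow· x (subSq f) y) (double-suc t) (double-suc m) ⟩
  xPow· (suc (suc (t + t))) (subSq f) (suc (suc (m + m)))  ≡⟨ xPow·-suc (suc (t + t)) (subSq f) (suc (m + m)) ⟩
  xPow· (suc (t + t)) (subSq f) (suc (m + m))              ≡⟨ xPow·-suc (t + t) (subSq f) (m + m) ⟩
  xPow· (t + t) (subSq f) (m + m)                          ≡⟨ xPow·-subSq-double t f m ⟩
  xPow· t f m                                              ≡⟨ xPow·-suc t f m ⟨
  xPow· (suc t) f (suc m)                                  ∎

xPow·-subSq-suc-double : ∀ t f m → xPow· (t + t) (subSq f) (suc (m + m)) ≡ 0
xPow·-subSq-suc-double zero    f m       = subSq-suc-double f m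
xPow·-subSq-suc-double (suc t) f zero    =
  trans (cong (λ x → xPow· x (subSq f) 1) (double-suc t)) (xPow·-suc (suc (t + t)) (subSq f) 0)
xPow·-subSq-suc-double (suc t) f (suc m) = begin
  xPow· (suc t + suc t) (subSq f) (suc (suc m + suc m))
    ≡⟨ cong₂ (λ x y → xPow· x (subSq f) (suc y)) (double-suc t) (double-suc m) ⟩
  xPow· (suc (suc (t + t))) (subSq f) (suc (suc (suc (m + m))))  ≡⟨ xPow·-suc (suc (t + t)) (subSq f) (suc (suc (m + m))) ⟩
  xPow· (suc (t + t)) (subSq f) (suc (suc (m + m)))              ≡⟨ xPow·-suc (t + t) (subSq f) (suc (m + m)) ⟩
  xPow· (t + t) (subSq f) (suc (m + m))                          ≡⟨ xPow·-subSq-suc-double t f m ⟩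
  0                                                              ∎

-- Lists and permutations of 1, …, n

∈-concatMap-find : ∀ {A B : Set} (f : A → List B) xs {z} → z ∈ concatMap f xs → ∃ λ x → x ∈ xs × z ∈ f x
∈-concatMap-find f xs z∈ = find (∈-concatMap⁻ f {xs} z∈)

∈-concatMap-intro : ∀ {A B : Set} (f : A → List B) {xs x z} → x ∈ xs → z ∈ f x → z ∈ concatMap f xs
∈-concatMap-intro f x∈ z∈ = ∈-concatMap⁺ f (lose x∈ z∈)

Unique-concatMap : ∀ {A B : Set} (f : A → List B) {xs} → Unique xs → (∀ {x} → x ∈ xs → Unique (f x))
  → (∀ {x y z} → x ∈ xs → y ∈ xs → z ∈ f x → z ∈ f y → x ≡ y) → Unique (concatMap f xs)
Unique-concatMap f {[]}     []           _        _        = []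
Unique-concatMap f {x ∷ xs} (x∉xs ∷ !xs) !f       disjoint =
  Unique.++⁺ (!f (here refl)) (Unique-concatMap f !xs (λ y∈ → !f (there y∈)) (λ p q → disjoint (there p) (there q))) apart
  where
  apart : ∀ {z} → z ∈ f x × z ∈ concatMap f xs → ⊥
  apart (z∈fx , z∈rest) with ∈-concatMap-find f xs z∈rest
  ... | y , y∈xs , z∈fy = All.lookup x∉xs y∈xs (disjoint (here refl) (there y∈xs) z∈fx z∈fy)

++-∷-injective : ∀ {A : Set} (p p′ : List A) {x s s′} → x ∉ p → x ∉ p′
  → p ++ x ∷ s ≡ p′ ++ x ∷ s′ → p ≡ p′ × s ≡ s′
++-∷-injective []      []        _    _     eq = refl , List.∷-injectiveʳ eq
++-∷-injective []      (y ∷ p′)  _    x∉p′  eq = ⊥-elim (x∉p′ (here (List.∷-injectiveˡ eq)))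
++-∷-injective (y ∷ p) []        x∉p  _     eq = ⊥-elim (x∉p (here (sym (List.∷-injectiveˡ eq))))
++-∷-injective (y ∷ p) (y′ ∷ p′) x∉p  x∉p′  eq with List.∷-injective eq
... | refl , eq′ with ++-∷-injective p p′ (λ x∈ → x∉p (there x∈)) (λ x∈ → x∉p′ (there x∈)) eq′
... | refl , refl = refl , refl

Unique-++-apart : ∀ {A : Set} {xs ys : List A} {x y} → Unique (xs ++ ys) → x ∈ xs → y ∈ ys → x ≢ y
Unique-++-apart {xs = _ ∷ xs} (x∉ ∷ _) (here refl) y∈ = All.lookup x∉ (∈-++⁺ʳ xs y∈)
Unique-++-apart {xs = _ ∷ xs} (_ ∷ !) (there x∈)  y∈ = Unique-++-apart ! x∈ y∈

filter-∧ : ∀ {A : Set} (p q : A → Bool) xs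
  → filter (λ x → T? (p x ∧ q x)) xs ≡ filter (λ x → T? (q x)) (filter (λ x → T? (p x)) xs)
filter-∧ p q []       = refl
filter-∧ p q (x ∷ xs) with p x
... | false = filter-∧ p q xs
... | true with q x
...   | true  = cong (x ∷_) (filter-∧ p q xs)
...   | false = filter-∧ p q xs

length-filter-++ : ∀ {A : Set} {P : A → Set} (P? : ∀ x → Dec (P x)) xs ys
  → length (filter P? (xs ++ ys)) ≡ length (filter P? xs) + length (filter P? ys)
length-filter-++ P? xs ys = trans (cong length (List.filter-++ P? xs ys)) (List.length-++ (filter P? xs))

length-filter-concatMap : ∀ {A B : Set} (P : B → Bool) (f : A → List B) xs
  → length (filter (λ y → T? (P y)) (concatMap f xs)) ≡ sum (map (λ x → length (filter (λ y → T? (P y)) (f x))) xs)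
length-filter-concatMap P f []       = refl
length-filter-concatMap P f (x ∷ xs) = begin
  length (filter P? (f x ++ concatMap f xs))                       ≡⟨ length-filter-++ P? (f x) (concatMap f xs) ⟩
  length (filter P? (f x)) + length (filter P? (concatMap f xs))
    ≡⟨ cong (length (filter P? (f x)) +_) (length-filter-concatMap P f xs) ⟩
  length (filter P? (f x)) + sum (map (λ x → length (filter P? (f x))) xs) ∎
  where
  P? = λ y → T? (P y)

length-filter-map : ∀ {A B : Set} (P : B → Bool) (Q : A → Bool) (g : A → B) ys → (∀ {y} → y ∈ ys → P (g y) ≡ Q y)
  → length (filter (λ z → T? (P z)) (map g ys)) ≡ length (filter (λ y → T? (Q y)) ys)
length-filter-map P Q g []       _     = refl
length-filter-map P Q g (y ∷ ys) P≡Q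
  with P (g y) | Q y | P≡Q (here refl) | length-filter-map P Q g ys (λ y∈ → P≡Q (there y∈))
... | true  | true  | refl | ih = cong suc ih
... | false | false | refl | ih = ih

sum-map-cong : ∀ {A : Set} {f g : A → ℕ} xs → (∀ {x} → x ∈ xs → f x ≡ g x) → sum (map f xs) ≡ sum (map g xs)
sum-map-cong []       _   = refl
sum-map-cong (x ∷ xs) f≡g = cong₂ _+_ (f≡g (here refl)) (sum-map-cong xs (λ x∈ → f≡g (there x∈)))

sum-map-const : ∀ {A : Set} (f : A → ℕ) xs k → (∀ {x} → x ∈ xs → f x ≡ k) → sum (map f xs) ≡ length xs * k
sum-map-const f []       k _    = refl
sum-map-const f (x ∷ xs) k f≡k = cong₂ _+_ (f≡k (here refl)) (sum-map-const f xs k (λ x∈ → f≡k (there x∈)))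

insertions⁻ : ∀ x σ {τ} → τ ∈ insertions x σ → ∃₂ λ p s → σ ≡ p ++ s × τ ≡ p ++ x ∷ s
insertions⁻ x []       (here refl) = [] , [] , refl , refl
insertions⁻ x (y ∷ σ)  (here refl) = [] , y ∷ σ , refl , refl
insertions⁻ x (y ∷ σ)  (there τ∈) with ∈-map⁻ (y ∷_) τ∈
... | τ , τ∈′ , refl with insertions⁻ x σ τ∈′
... | p , s , refl , refl = y ∷ p , s , refl , refl

insertions⁺ : ∀ x p s → p ++ x ∷ s ∈ insertions x (p ++ s)
insertions⁺ x []      []      = here refl
insertions⁺ x []      (y ∷ s) = here refl
insertions⁺ x (y ∷ p) s       = there (∈-map⁺ (y ∷_) (insertions⁺ x p s))

Unique-insertions : ∀ x σ → x ∉ σ → Unique (insertions x σ)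
Unique-insertions x []      _   = [] ∷ []
Unique-insertions x (y ∷ σ) x∉ =
  All.map⁺ (All.universal head≢ _) ∷ Unique.map⁺ List.∷-injectiveʳ (Unique-insertions x σ (λ x∈ → x∉ (there x∈)))
  where
  head≢ : ∀ τ → x ∷ y ∷ σ ≢ y ∷ τ
  head≢ τ eq = x∉ (here (List.∷-injectiveˡ eq))

insertions-injective : ∀ x {σ σ′ τ} → x ∉ σ → x ∉ σ′ → τ ∈ insertions x σ → τ ∈ insertions x σ′ → σ ≡ σ′
insertions-injective x {σ} {σ′} x∉σ x∉σ′ τ∈ τ∈′
  with insertions⁻ x σ τ∈ | insertions⁻ x σ′ τ∈′
... | p , s , refl , refl | p′ , s′ , refl , eq
  with ++-∷-injective p p′ (λ x∈ → x∉σ (∈-++⁺ˡ x∈)) (λ x∈ → x∉σ′ (∈-++⁺ˡ x∈)) eq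
... | refl , refl = refl

perms-↭ : ∀ l {π} → π ∈ perms l → π ↭ l
perms-↭ []      (here refl) = ↭-refl
perms-↭ (x ∷ l) π∈ with ∈-concatMap-find (insertions x) (perms l) π∈
... | σ , σ∈ , π∈′ with insertions⁻ x σ π∈′
... | p , s , refl , refl = ↭-trans (shift x p s) (↭-prep x (perms-↭ l σ∈))

↭⇒∈-perms : ∀ l {π} → π ↭ l → π ∈ perms l
↭⇒∈-perms []      π↭ rewrite ↭-empty-inv π↭ = here refl
↭⇒∈-perms (x ∷ l) π↭ with ∈-∃++ (∈-resp-↭ (↭-sym π↭) (here refl))
... | p , s , refl = ∈-concatMap-intro (insertions x) (↭⇒∈-perms l (drop-mid p [] π↭)) (insertions⁺ x p s)

Unique-perms : ∀ {l} → Unique l → Unique (perms l)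
Unique-perms {[]}    _          = [] ∷ []
Unique-perms {x ∷ l} (x∉l ∷ !l) =
  Unique-concatMap (insertions x) (Unique-perms !l)
    (λ σ∈ → Unique-insertions x _ (x∉ σ∈))
    (λ σ∈ σ′∈ → insertions-injective x (x∉ σ∈) (x∉ σ′∈))
  where
  x∉ : ∀ {σ} → σ ∈ perms l → x ∉ σ
  x∉ σ∈ x∈σ = All.lookup x∉l (∈-resp-↭ (perms-↭ l σ∈) x∈σ) refl

applyUpTo-+ : ∀ {A : Set} (f : ℕ → A) b c → applyUpTo f (b + c) ≡ applyUpTo f b ++ applyUpTo (λ i → f (b + i)) c
applyUpTo-+ f zero    c = refl
applyUpTo-+ f (suc b) c = cong (f 0 ∷_) (applyUpTo-+ (λ i → f (suc i)) b c)

oneTo-+ : ∀ b c → oneTo (b + c) ≡ oneTo b ++ map (b +_) (oneTo c)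
oneTo-+ b c = begin
  oneTo (b + c)                                   ≡⟨ applyUpTo-+ suc b c ⟩
  oneTo b ++ applyUpTo (λ i → suc (b + i)) c      ≡⟨ cong (oneTo b ++_) high ⟩
  oneTo b ++ map (b +_) (oneTo c)                 ∎
  where
  high : applyUpTo (λ i → suc (b + i)) c ≡ map (b +_) (oneTo c)
  high = begin
    applyUpTo (λ i → suc (b + i)) c      ≡⟨ List.map-upTo _ c ⟨
    map (λ i → suc (b + i)) (upTo c)     ≡⟨ List.map-cong (λ i → sym (+-suc b i)) (upTo c) ⟩
    map (λ i → b + suc i) (upTo c)       ≡⟨ List.map-upTo _ c ⟩
    applyUpTo (λ i → b + suc i) c        ≡⟨ List.map-applyUpTo suc (b +_) c ⟨
    map (b +_) (oneTo c)                 ∎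

oneTo-suc : ∀ n → oneTo (suc n) ≡ oneTo n ++ [ suc n ]
oneTo-suc n = sym (List.applyUpTo-∷ʳ suc n)

∈-oneTo⁻ : ∀ {n x} → x ∈ oneTo n → 1 ≤ x × x ≤ n
∈-oneTo⁻ x∈ with ∈-applyUpTo⁻ suc x∈
... | i , i<n , refl = s≤s z≤n , i<n

∈-oneTo⁺ : ∀ {n x} → 1 ≤ x → x ≤ n → x ∈ oneTo n
∈-oneTo⁺ {n} {suc i} _ x≤n = ∈-applyUpTo⁺ suc x≤n

Unique-oneTo : ∀ n → Unique (oneTo n)
Unique-oneTo n = Unique.applyUpTo⁺₁ suc n (λ i<j _ eq → <⇒≢ i<j (suc-injective eq))

length-oneTo : ∀ n → length (oneTo n) ≡ n
length-oneTo = List.length-applyUpTo suc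

∈-↭-oneTo : ∀ {π n x} → π ↭ oneTo n → x ∈ π → 1 ≤ x × x ≤ n
∈-↭-oneTo π↭ x∈ = ∈-oneTo⁻ (∈-resp-↭ π↭ x∈)

length-↭-oneTo : ∀ {π n} → π ↭ oneTo n → length π ≡ n
length-↭-oneTo π↭ = trans (↭-length π↭) (length-oneTo _)

∈-shifted-oneTo⁻ : ∀ {b c v} → v ∈ map (b +_) (oneTo c) → b < v × v ≤ b + c
∈-shifted-oneTo⁻ {b} v∈ with ∈-map⁻ (b +_) v∈
... | w , w∈ , refl with ∈-oneTo⁻ w∈
... | 1≤w , w≤c = subst (_< b + w) (+-identityʳ b) (+-monoʳ-< b 1≤w) , +-monoʳ-≤ b w≤c

∈-shifted-↭-oneTo : ∀ {α b c v} → α ↭ oneTo c → v ∈ map (b +_) α → b < v × v ≤ b + c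
∈-shifted-↭-oneTo {b = b} α↭ v∈ = ∈-shifted-oneTo⁻ (∈-resp-↭ (↭.map⁺ (b +_) α↭) v∈)

filter-≤-oneTo : ∀ t k → filter (_≤? t) (oneTo (t + k)) ≡ oneTo t
filter-≤-oneTo t k = begin
  filter (_≤? t) (oneTo (t + k))
    ≡⟨ cong (filter (_≤? t)) (oneTo-+ t k) ⟩
  filter (_≤? t) (oneTo t ++ map (t +_) (oneTo k))
    ≡⟨ List.filter-++ (_≤? t) (oneTo t) _ ⟩
  filter (_≤? t) (oneTo t) ++ filter (_≤? t) (map (t +_) (oneTo k))
    ≡⟨ cong₂ _++_ (List.filter-all (_≤? t) (All.tabulate (λ x∈ → proj₂ (∈-oneTo⁻ x∈))))
                  (List.filter-none (_≤? t) {map (t +_) (oneTo k)} (All.tabulate (λ x∈ → <⇒≱ (proj₁ (∈-shifted-oneTo⁻ x∈))))) ⟩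
  oneTo t ++ []
    ≡⟨ List.++-identityʳ (oneTo t) ⟩
  oneTo t ∎

filter->-oneTo : ∀ t k → filter (t <?_) (oneTo (t + k)) ≡ map (t +_) (oneTo k)
filter->-oneTo t k = begin
  filter (t <?_) (oneTo (t + k))
    ≡⟨ cong (filter (t <?_)) (oneTo-+ t k) ⟩
  filter (t <?_) (oneTo t ++ map (t +_) (oneTo k))
    ≡⟨ List.filter-++ (t <?_) (oneTo t) _ ⟩
  filter (t <?_) (oneTo t) ++ filter (t <?_) (map (t +_) (oneTo k))
    ≡⟨ cong₂ _++_ (List.filter-none (t <?_) (All.tabulate (λ x∈ → ≤⇒≯ (proj₂ (∈-oneTo⁻ x∈)))))
                  (List.filter-all (t <?_) {map (t +_) (oneTo k)} (All.tabulate (λ x∈ → proj₁ (∈-shifted-oneTo⁻ x∈)))) ⟩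
  map (t +_) (oneTo k) ∎

↭-oneTo-count-≤ : ∀ {zs N t} → zs ↭ oneTo N → t ≤ N → length (filter (_≤? t) zs) ≡ t
↭-oneTo-count-≤ {zs} {N} {t} zs↭ t≤N = begin
  length (filter (_≤? t) zs)                      ≡⟨ ↭-length (filter-↭ (_≤? t) zs↭) ⟩
  length (filter (_≤? t) (oneTo N))               ≡⟨ cong (λ n → length (filter (_≤? t) (oneTo n))) (m+[n∸m]≡n t≤N) ⟨
  length (filter (_≤? t) (oneTo (t + (N ∸ t))))   ≡⟨ cong length (filter-≤-oneTo t (N ∸ t)) ⟩
  length (oneTo t)                                ≡⟨ length-oneTo t ⟩
  t                                               ∎

-- An entry v of a permutation of 1, …, N is the number of its entries ≤ v.
↭-oneTo-split : ∀ xs ys → xs ++ ys ↭ oneTo (length ys + length xs) → (∀ {x y} → x ∈ xs → y ∈ ys → y < x)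
  → ys ↭ oneTo (length ys) × xs ↭ map (length ys +_) (oneTo (length xs))
↭-oneTo-split xs ys zs↭ y<x = ys↭ , xs↭
  where
  b = length ys
  c = length xs
  count : ∀ {v} → v ∈ xs ++ ys → length (filter (_≤? v) (xs ++ ys)) ≡ v
  count v∈ = ↭-oneTo-count-≤ zs↭ (proj₂ (∈-↭-oneTo zs↭ v∈))
  low : ∀ {y} → y ∈ ys → y ≤ b
  low {y} y∈ = subst (_≤ b) (begin
    length (filter (_≤? y) ys)
      ≡⟨ cong (λ l → length l + _) (List.filter-none (_≤? y) (All.tabulate (λ x∈ → <⇒≱ (y<x x∈ y∈)))) ⟨
    length (filter (_≤? y) xs) + length (filter (_≤? y) ys)
      ≡⟨ length-filter-++ (_≤? y) xs ys ⟨
    length (filter (_≤? y) (xs ++ ys))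
      ≡⟨ count (∈-++⁺ʳ xs y∈) ⟩
    y ∎) (List.length-filter (_≤? y) ys)
  high : ∀ {x} → x ∈ xs → b < x
  high {x} x∈ = subst (b <_) (begin
    length (filter (_≤? x) xs) + b
      ≡⟨ cong (λ l → length (filter (_≤? x) xs) + length l)
              (List.filter-all (_≤? x) (All.tabulate (λ y∈ → <⇒≤ (y<x x∈ y∈)))) ⟨
    length (filter (_≤? x) xs) + length (filter (_≤? x) ys)
      ≡⟨ length-filter-++ (_≤? x) xs ys ⟨
    length (filter (_≤? x) (xs ++ ys))
      ≡⟨ count (∈-++⁺ˡ x∈) ⟩
    x ∎) (+-monoˡ-≤ b (List.filter-some (_≤? x) (Any.map (λ x≡ → ≤-reflexive (sym x≡)) x∈)))
  ys↭ : ys ↭ oneTo b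
  ys↭ = subst₂ _↭_ ys≡ (filter-≤-oneTo b c) (filter-↭ (_≤? b) zs↭)
    where
    ys≡ : filter (_≤? b) (xs ++ ys) ≡ ys
    ys≡ = trans (List.filter-++ (_≤? b) xs ys)
                (cong₂ _++_ (List.filter-none (_≤? b) (All.tabulate (λ x∈ → <⇒≱ (high x∈))))
                            (List.filter-all (_≤? b) (All.tabulate low)))
  xs↭ : xs ↭ map (b +_) (oneTo c)
  xs↭ = subst₂ _↭_ xs≡ (filter->-oneTo b c) (filter-↭ (b <?_) zs↭)
    where
    xs≡ : filter (b <?_) (xs ++ ys) ≡ xs
    xs≡ = trans (List.filter-++ (b <?_) xs ys)
                (trans (cong₂ _++_ (List.filter-all (b <?_) (All.tabulate high))
                                   (List.filter-none (b <?_) (All.tabulate (λ y∈ → ≤⇒≯ (low y∈)))))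
                       (List.++-identityʳ xs))

drop-max : ∀ {n} xs ys → xs ++ suc n ∷ ys ↭ oneTo (suc n) → xs ++ ys ↭ oneTo n
drop-max {n} xs ys π↭ =
  subst (xs ++ ys ↭_) (List.++-identityʳ (oneTo n)) (drop-mid xs (oneTo n) (subst (xs ++ suc n ∷ ys ↭_) (oneTo-suc n) π↭))

glue : ℕ → ℕ → List ℕ → List ℕ → List ℕ
glue b m α β = map (b +_) α ++ m ∷ β

glue-↭ : ∀ {b c n α β} → b + c ≡ n → α ↭ oneTo c → β ↭ oneTo b → glue b (suc n) α β ↭ oneTo (suc n)
glue-↭ {b} {c} {α = α} {β} refl α↭ β↭ = ↭R.begin
  map (b +_) α ++ m ∷ β                  ↭R.↭⟨ ↭.++⁺ (↭.map⁺ (b +_) α↭) (↭-prep m β↭) ⟩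
  map (b +_) (oneTo c) ++ m ∷ oneTo b    ↭R.↭⟨ shift m (map (b +_) (oneTo c)) (oneTo b) ⟩
  m ∷ (map (b +_) (oneTo c) ++ oneTo b)  ↭R.↭⟨ ↭-prep m (↭.++-comm (map (b +_) (oneTo c)) (oneTo b)) ⟩
  m ∷ (oneTo b ++ map (b +_) (oneTo c))  ↭R.≡⟨ cong (m ∷_) (oneTo-+ b c) ⟨
  m ∷ oneTo (b + c)                      ↭R.↭⟨ ↭.∷↭∷ʳ m (oneTo (b + c)) ⟩
  oneTo (b + c) ++ [ m ]                 ↭R.≡⟨ oneTo-suc (b + c) ⟨
  oneTo m                                ↭R.∎
  where
  module ↭R = PermutationReasoning
  m = suc (b + c)

-- Dumont, 132 and right-to-left maxima around a maximal entry

<⇒<ᵇ≡true : ∀ {m n} → m < n → (m <ᵇ n) ≡ true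
<⇒<ᵇ≡true {zero}  {suc n} _         = refl
<⇒<ᵇ≡true {suc m} {suc n} (s≤s m<n) = <⇒<ᵇ≡true m<n

<ᵇ≡true⇒< : ∀ m n → (m <ᵇ n) ≡ true → m < n
<ᵇ≡true⇒< zero    (suc n) _  = s≤s z≤n
<ᵇ≡true⇒< (suc m) (suc n) eq = s≤s (<ᵇ≡true⇒< m n eq)

≤⇒>ᵇ≡false : ∀ {m n} → n ≤ m → (m <ᵇ n) ≡ false
≤⇒>ᵇ≡false {m}     {zero}  _         = refl
≤⇒>ᵇ≡false {suc m} {suc n} (s≤s n≤m) = ≤⇒>ᵇ≡false n≤m

+-<ᵇ-+ : ∀ b m n → (b + m <ᵇ b + n) ≡ (m <ᵇ n)
+-<ᵇ-+ zero    m n = refl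
+-<ᵇ-+ (suc b) m n = +-<ᵇ-+ b m n

any-true : ∀ {A : Set} (p : A → Bool) {x xs} → x ∈ xs → p x ≡ true → any p xs ≡ true
any-true p {xs = y ∷ xs} (here refl) px = cong (_∨ any p xs) px
any-true p {xs = y ∷ xs} (there x∈)  px = trans (cong (p y ∨_) (any-true p x∈ px)) (∨-zeroʳ (p y))

any-false : ∀ {A : Set} (p : A → Bool) {xs} → All (λ x → p x ≡ false) xs → any p xs ≡ false
any-false p []         = refl
any-false p (px ∷ pxs) = cong₂ _∨_ px (any-false p pxs)

any-++-false : ∀ {A : Set} (p : A → Bool) xs {ys} → any p ys ≡ false → any p (xs ++ ys) ≡ any p xs
any-++-false p []       none = none
any-++-false p (x ∷ xs) none = cong (p x ∨_) (any-++-false p xs none)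

all-true : ∀ {A : Set} (p : A → Bool) {xs} → All (λ x → p x ≡ true) xs → all p xs ≡ true
all-true p []         = refl
all-true p (px ∷ pxs) = cong₂ _∧_ px (all-true p pxs)

all-false : ∀ {A : Set} (p : A → Bool) {x xs} → x ∈ xs → p x ≡ false → all p xs ≡ false
all-false p {xs = y ∷ xs} (here refl) px = cong (_∧ all p xs) px
all-false p {xs = y ∷ xs} (there x∈)  px = trans (cong (p y ∧_) (all-false p x∈ px)) (∧-zeroʳ (p y))

isDumont-++-∷ : ∀ xs n ys → All (_< n) xs → isDumont (xs ++ n ∷ ys) ≡ isDumont xs ∧ isDumont (n ∷ ys)
isDumont-++-∷ []            n ys []                = refl
isDumont-++-∷ (x ∷ [])      n ys (x<n ∷ [])        = cong (_∧ isDumont (n ∷ ys)) ascent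
  where
  ascent : (if isEven x then n <ᵇ x else x <ᵇ n) ≡ not (isEven x)
  ascent with isEven x
  ... | true  = ≤⇒>ᵇ≡false (<⇒≤ x<n)
  ... | false = <⇒<ᵇ≡true x<n
isDumont-++-∷ (x ∷ x′ ∷ xs) n ys (_ ∷ xs<n) =
  trans (cong (step ∧_) (isDumont-++-∷ (x′ ∷ xs) n ys xs<n)) (sym (∧-assoc step _ _))
  where step = if isEven x then x′ <ᵇ x else x <ᵇ x′

isDumont-∷-< : ∀ n y ys → y < n → isDumont (n ∷ y ∷ ys) ≡ isEven n ∧ isDumont (y ∷ ys)
isDumont-∷-< n y ys y<n with isEven n
... | true  = cong (_∧ isDumont (y ∷ ys)) (<⇒<ᵇ≡true y<n)
... | false = cong (_∧ isDumont (y ∷ ys)) (≤⇒>ᵇ≡false (<⇒≤ y<n))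

isDumont-tail : ∀ x l → isDumont (x ∷ l) ≡ true → isDumont l ≡ true
isDumont-tail x []      _ = refl
isDumont-tail x (y ∷ l) d = ∧-conicalʳ _ _ d

isDumont-even-descent : ∀ p e f r → isDumont (p ++ e ∷ f ∷ r) ≡ true → isEven e ≡ true → f < e
isDumont-even-descent []      e f r d ev rewrite ev = <ᵇ≡true⇒< f e (∧-conicalˡ _ _ d)
isDumont-even-descent (x ∷ p) e f r d ev = isDumont-even-descent p e f r (isDumont-tail x (p ++ e ∷ f ∷ r) d) ev

isDumont-shift : ∀ b α → isEven b ≡ true → isDumont (map (b +_) α) ≡ isDumont α
isDumont-shift b []          _  = refl
isDumont-shift b (x ∷ [])    ev = cong not (isEven-+ b x ev)
isDumont-shift b (x ∷ y ∷ α) ev = cong₂ _∧_ step (isDumont-shift b (y ∷ α) ev)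
  where
  step : (if isEven (b + x) then b + y <ᵇ b + x else b + x <ᵇ b + y) ≡ (if isEven x then y <ᵇ x else x <ᵇ y)
  step rewrite isEven-+ b x ev | +-<ᵇ-+ b y x | +-<ᵇ-+ b x y = refl

has21above-≤ : ∀ a {l} → All (_≤ a) l → has21above a l ≡ false
has21above-≤ a []          = refl
has21above-≤ a {b ∷ l} (_ ∷ l≤a) =
  cong₂ _∨_ (any-false (λ c → (a <ᵇ c) ∧ (c <ᵇ b)) (All.map (λ {c} c≤a → cong (_∧ (c <ᵇ b)) (≤⇒>ᵇ≡false c≤a)) l≤a))
            (has21above-≤ a l≤a)

has21above-++-∷ : ∀ a xs n ys → a < n → All (_< n) xs → All (_< a) ys → has21above a (xs ++ n ∷ ys) ≡ has21above a xs
has21above-++-∷ a []       n ys a<n []          ys<a =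
  cong₂ _∨_ (any-false (λ d → (a <ᵇ d) ∧ (d <ᵇ n)) (All.map (λ {d} d<a → cong (_∧ (d <ᵇ n)) (≤⇒>ᵇ≡false (<⇒≤ d<a))) ys<a))
            (has21above-≤ a (All.map <⇒≤ ys<a))
has21above-++-∷ a (c ∷ xs) n ys a<n (c<n ∷ xs<n) ys<a =
  cong₂ _∨_ (any-++-false (λ d → (a <ᵇ d) ∧ (d <ᵇ c)) xs (cong₂ _∨_ n-above-c ys-below-a))
            (has21above-++-∷ a xs n ys a<n xs<n ys<a)
  where
  n-above-c : ((a <ᵇ n) ∧ (n <ᵇ c)) ≡ false
  n-above-c = trans (cong ((a <ᵇ n) ∧_) (≤⇒>ᵇ≡false (<⇒≤ c<n))) (∧-zeroʳ _)
  ys-below-a : any (λ d → (a <ᵇ d) ∧ (d <ᵇ c)) ys ≡ false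
  ys-below-a = any-false (λ d → (a <ᵇ d) ∧ (d <ᵇ c)) (All.map (λ {d} d<a → cong (_∧ (d <ᵇ c)) (≤⇒>ᵇ≡false (<⇒≤ d<a))) ys<a)

contains132-++-∷ : ∀ xs n ys → All (_< n) xs → All (_< n) ys → (∀ {x y} → x ∈ xs → y ∈ ys → y < x)
  → contains132 (xs ++ n ∷ ys) ≡ contains132 xs ∨ contains132 ys
contains132-++-∷ []       n ys []           ys<n _   = cong (_∨ contains132 ys) (has21above-≤ n (All.map <⇒≤ ys<n))
contains132-++-∷ (x ∷ xs) n ys (x<n ∷ xs<n) ys<n y<x =
  trans (cong₂ _∨_ (has21above-++-∷ x xs n ys x<n xs<n (All.tabulate (y<x (here refl))))
                   (contains132-++-∷ xs n ys xs<n ys<n (λ x∈ → y<x (there x∈))))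
        (sym (∨-assoc (has21above x xs) (contains132 xs) (contains132 ys)))

has21above-occurrence : ∀ q r {a b c} → c ∈ r → a < c → c < b → has21above a (q ++ b ∷ r) ≡ true
has21above-occurrence []      r {a} {b} c∈ a<c c<b =
  cong (_∨ has21above a r) (any-true (λ c → (a <ᵇ c) ∧ (c <ᵇ b)) c∈ (cong₂ _∧_ (<⇒<ᵇ≡true a<c) (<⇒<ᵇ≡true c<b)))
has21above-occurrence (d ∷ q) r {a} {b} c∈ a<c c<b =
  trans (cong (any (λ c → (a <ᵇ c) ∧ (c <ᵇ d)) (q ++ b ∷ r) ∨_) (has21above-occurrence q r c∈ a<c c<b)) (∨-zeroʳ _)

contains132-occurrence : ∀ p q r {a b c} → c ∈ r → a < c → c < b → contains132 (p ++ a ∷ q ++ b ∷ r) ≡ true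
contains132-occurrence []      q r {b = b} c∈ a<c c<b =
  cong (_∨ contains132 (q ++ b ∷ r)) (has21above-occurrence q r c∈ a<c c<b)
contains132-occurrence (x ∷ p) q r {a} {b} c∈ a<c c<b =
  trans (cong (has21above x (p ++ a ∷ q ++ b ∷ r) ∨_) (contains132-occurrence p q r c∈ a<c c<b)) (∨-zeroʳ _)

contains132-shift : ∀ b l → contains132 (map (b +_) l) ≡ contains132 l
contains132-shift b []      = refl
contains132-shift b (a ∷ l) = cong₂ _∨_ (has21above-shift a l) (contains132-shift b l)
  where
  any-shift : ∀ a d l → any (λ c → (b + a <ᵇ c) ∧ (c <ᵇ b + d)) (map (b +_) l) ≡ any (λ c → (a <ᵇ c) ∧ (c <ᵇ d)) l
  any-shift a d []      = refl
  any-shift a d (c ∷ l) = cong₂ _∨_ (cong₂ _∧_ (+-<ᵇ-+ b a c) (+-<ᵇ-+ b c d)) (any-shift a d l)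
  has21above-shift : ∀ a l → has21above (b + a) (map (b +_) l) ≡ has21above a l
  has21above-shift a []      = refl
  has21above-shift a (d ∷ l) = cong₂ _∨_ (any-shift a d l) (has21above-shift a l)

rlMaxCount-++-∷ : ∀ xs n ys → All (_< n) xs → All (_< n) ys → rlMaxCount (xs ++ n ∷ ys) ≡ suc (rlMaxCount ys)
rlMaxCount-++-∷ []       n ys []           ys<n =
  cong (λ t → (if t then 1 else 0) + rlMaxCount ys) (all-true (_<ᵇ n) (All.map <⇒<ᵇ≡true ys<n))
rlMaxCount-++-∷ (x ∷ xs) n ys (x<n ∷ xs<n) ys<n =
  trans (cong (λ t → (if t then 1 else 0) + rlMaxCount (xs ++ n ∷ ys))
              (all-false (_<ᵇ x) (∈-++⁺ʳ xs (here refl)) (≤⇒>ᵇ≡false (<⇒≤ x<n))))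
        (rlMaxCount-++-∷ xs n ys xs<n ys<n)

rlMaxCount-∷ : ∀ x xs → rlMaxCount (x ∷ xs) ≢ 0
rlMaxCount-∷ x []       ()
rlMaxCount-∷ x (y ∷ xs) eq = rlMaxCount-∷ y xs (m+n≡0⇒n≡0 (if all (_<ᵇ x) (y ∷ xs) then 1 else 0) eq)

-- Splitting a good permutation at its maximum

isGood : List ℕ → Bool
isGood π = isDumont π ∧ avoids132 π

Good : ℕ → List (List ℕ)
Good n = filter (λ π → T? (isGood π)) (Sym n)

record GoodPerm (n : ℕ) (π : List ℕ) : Set where
  constructor goodPerm
  field
    perm   : π ↭ oneTo n
    dumont : isDumont π ≡ true
    avoids : contains132 π ≡ false

∈-Good⇔ : ∀ {n π} → π ∈ Good n ⇔ GoodPerm n π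
∈-Good⇔ {n} {π} = mk⇔ to′ from′
  where
  to′ : π ∈ Good n → GoodPerm n π
  to′ π∈ with ∈-filter⁻ (λ π → T? (isGood π)) {xs = Sym n} π∈
  ... | π∈Sym , t with T-∧ .to t
  ... | d , a = goodPerm (perms-↭ (oneTo n) π∈Sym) (T-≡ .to d) (T-not-≡ .to a)
  from′ : GoodPerm n π → π ∈ Good n
  from′ (goodPerm π↭ d a) =
    ∈-filter⁺ (λ π → T? (isGood π)) (↭⇒∈-perms (oneTo n) π↭) (T-∧ .from (T-≡ .from d , T-not-≡ .from a))

Unique-Good : ∀ n → Unique (Good n)
Unique-Good n = Unique.filter⁺ (λ π → T? (isGood π)) (Unique-perms (Unique-oneTo n))

-- The sizes b such that suc n can be followed by exactly b entries in a good
-- permutation of length suc n.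
record Admissible (n b : ℕ) : Set where
  field
    b≤n        : b ≤ n
    prefix     : n ∸ b ≡ 0 ⊎ isEven b ≡ true
    max-parity : isEven (suc n) ≡ (0 <ᵇ b)

isDumont-max⁻ : ∀ m β → All (_< m) β → isDumont (m ∷ β) ≡ true → isDumont β ≡ true × isEven m ≡ (0 <ᵇ length β)
isDumont-max⁻ m []      _         d = refl , trans (sym (not-involutive (isEven m))) (cong not d)
isDumont-max⁻ m (y ∷ β) (y<m ∷ _) d = ∧-conicalʳ _ _ ev∧d , ∧-conicalˡ _ _ ev∧d
  where ev∧d = trans (sym (isDumont-∷-< m y β y<m)) d

isDumont-max⁺ : ∀ m β → All (_< m) β → isDumont β ≡ true → isEven m ≡ (0 <ᵇ length β) → isDumont (m ∷ β) ≡ true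
isDumont-max⁺ m []      _         _ ev = cong not ev
isDumont-max⁺ m (y ∷ β) (y<m ∷ _) d ev = trans (isDumont-∷-< m y β y<m) (cong₂ _∧_ ev d)

isDumont-shift-prefix : ∀ {b c α} → c ≡ 0 ⊎ isEven b ≡ true → α ↭ oneTo c → isDumont (map (b +_) α) ≡ isDumont α
isDumont-shift-prefix             (inj₁ refl) α↭ rewrite ↭-empty-inv α↭ = refl
isDumont-shift-prefix {b} {α = α} (inj₂ ev)   _  = isDumont-shift b α ev

-- If b is odd, the least entry b + 1 of a nonempty prefix is even, yet it is
-- followed by a larger entry.
prefix-parity : ∀ b c {α m ys} → α ↭ oneTo c → All (_< m) (map (b +_) α) → isDumont (map (b +_) α ++ m ∷ ys) ≡ true
  → c ≡ 0 ⊎ isEven b ≡ true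
prefix-parity b zero    _ _ _ = inj₁ refl
prefix-parity b (suc c) {α} {m} {ys} α↭ α′<m d with isEven b in b-parity
... | true  = inj₂ refl
... | false with ∈-∃++ (subst (_∈ map (b +_) α) (+-comm b 1) (∈-map⁺ (b +_) (∈-resp-↭ (↭-sym α↭) (here refl))))
...   | u , v , u++e∷v≡ = ⊥-elim (next-is-larger v (λ f∈ → e≤ (∈-++⁺ʳ u (there f∈)))
                                 (subst (λ l → isDumont l ≡ true) (trans (cong (_++ m ∷ ys) u++e∷v≡) (List.++-assoc u (e ∷ v) (m ∷ ys))) d))
  where
  e = suc b
  e-even : isEven e ≡ true
  e-even = trans (isEven-suc b) (cong not b-parity)
  e≤ : ∀ {f} → f ∈ u ++ e ∷ v → e ≤ f
  e≤ f∈ = proj₁ (∈-shifted-↭-oneTo α↭ (subst (_ ∈_) (sym u++e∷v≡) f∈))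
  next-is-larger : ∀ w → (∀ {f} → f ∈ w → e ≤ f) → isDumont (u ++ e ∷ w ++ m ∷ ys) ≡ true → ⊥
  next-is-larger []      _   d′ =
    <⇒≱ (isDumont-even-descent u e m ys d′ e-even) (<⇒≤ (All.lookup α′<m (subst (_ ∈_) (sym u++e∷v≡) (∈-++⁺ʳ u (here refl)))))
  next-is-larger (f ∷ w) e≤w d′ = <⇒≱ (isDumont-even-descent u e f (w ++ m ∷ ys) d′ e-even) (e≤w (here refl))

-- An entry x before the maximum m and a larger entry y after it would form a 132.
avoids132-max-split : ∀ xs m ys → contains132 (xs ++ m ∷ ys) ≡ false → All (_< m) ys
  → (∀ {x y} → x ∈ xs → y ∈ ys → x ≢ y) → ∀ {x y} → x ∈ xs → y ∈ ys → y < x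
avoids132-max-split xs m ys avoid ys<m apart {x} {y} x∈ y∈ with <-cmp x y
... | tri> _ _ y<x = y<x
... | tri≈ _ x≡y _ = ⊥-elim (apart x∈ y∈ x≡y)
... | tri< x<y _ _ with ∈-∃++ x∈
...   | p , q , refl = ⊥-elim (false≢true (trans (sym avoid) occurrence))
  where
  occurrence : contains132 ((p ++ x ∷ q) ++ m ∷ ys) ≡ true
  occurrence = trans (cong contains132 (List.++-assoc p (x ∷ q) (m ∷ ys)))
                     (contains132-occurrence p q ys y∈ x<y (All.lookup ys<m y∈))

glue-bounds : ∀ {n b α β} → b ≤ n → α ↭ oneTo (n ∸ b) → β ↭ oneTo b
  → All (_< suc n) (map (b +_) α) × All (_< suc n) β × (∀ {x y} → x ∈ map (b +_) α → y ∈ β → y < x)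
glue-bounds {n} b≤n α↭ β↭ =
  All.tabulate (λ v∈ → s≤s (subst (_ ≤_) (m+[n∸m]≡n b≤n) (proj₂ (∈-shifted-↭-oneTo α↭ v∈)))) ,
  All.tabulate (λ v∈ → s≤s (≤-trans (proj₂ (∈-↭-oneTo β↭ v∈)) b≤n)) ,
  λ x∈ y∈ → ≤-<-trans (proj₂ (∈-↭-oneTo β↭ y∈)) (proj₁ (∈-shifted-↭-oneTo α↭ x∈))

max-blocks : ∀ {n} xs ys → xs ++ suc n ∷ ys ↭ oneTo (suc n) → contains132 (xs ++ suc n ∷ ys) ≡ false
  → ∃ λ α → xs ≡ map (length ys +_) α × α ↭ oneTo (n ∸ length ys) × ys ↭ oneTo (length ys) × length ys ≤ n
max-blocks {n} xs ys π↭ avoids =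
  α , xs≡ , subst (λ t → α ↭ oneTo t) (sym n∸b≡c) α↭ , proj₁ blocks , subst (b ≤_) (sym n≡b+c) (m≤m+n b c)
  where
  b = length ys
  c = length xs
  rest↭ : xs ++ ys ↭ oneTo n
  rest↭ = drop-max xs ys π↭
  n≡b+c : n ≡ b + c
  n≡b+c = trans (sym (length-↭-oneTo rest↭)) (trans (List.length-++ xs) (+-comm c b))
  n∸b≡c : n ∸ b ≡ c
  n∸b≡c = trans (cong (_∸ b) n≡b+c) (m+n∸m≡n b c)
  ys<n : All (_< suc n) ys
  ys<n = All.tabulate (λ y∈ → s≤s (proj₂ (∈-↭-oneTo rest↭ (∈-++⁺ʳ xs y∈))))
  ys<xs : ∀ {x y} → x ∈ xs → y ∈ ys → y < x
  ys<xs = avoids132-max-split xs (suc n) ys avoids ys<n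
            (Unique-++-apart (Unique-resp-↭ (↭⇒↭ₛ (↭-sym rest↭)) (Unique-oneTo n)))
  blocks : ys ↭ oneTo b × xs ↭ map (b +_) (oneTo c)
  blocks = ↭-oneTo-split xs ys (subst (λ t → xs ++ ys ↭ oneTo t) n≡b+c rest↭) ys<xs
  unshifted : ∃ λ α → xs ≡ map (b +_) α × oneTo c ↭ α
  unshifted = ↭.↭-map-inv (b +_) (↭-sym (proj₂ blocks))
  α = proj₁ unshifted
  xs≡ : xs ≡ map (b +_) α
  xs≡ = proj₁ (proj₂ unshifted)
  α↭ : α ↭ oneTo c
  α↭ = ↭-sym (proj₂ (proj₂ unshifted))

good-split : ∀ {n} xs ys → GoodPerm (suc n) (xs ++ suc n ∷ ys)
  → ∃ λ α → xs ≡ map (length ys +_) α × Admissible n (length ys) × GoodPerm (n ∸ length ys) α × GoodPerm (length ys) ys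
good-split {n} xs ys (goodPerm π↭ dumont avoids) with max-blocks xs ys π↭ avoids
... | α , refl , α↭ , ys↭ , b≤n with glue-bounds b≤n α↭ ys↭
... | α′<n , ys<n , ys<α′ =
  α , refl , admissible , goodPerm α↭ α-dumont α-avoids , goodPerm ys↭ (proj₁ ys-max) (proj₂ avoids-parts)
  where
  b = length ys
  dumont-parts : isDumont (map (b +_) α) ∧ isDumont (suc n ∷ ys) ≡ true
  dumont-parts = trans (sym (isDumont-++-∷ (map (b +_) α) (suc n) ys α′<n)) dumont
  avoids-parts : contains132 (map (b +_) α) ≡ false × contains132 ys ≡ false
  avoids-parts with trans (sym (contains132-++-∷ (map (b +_) α) (suc n) ys α′<n ys<n ys<α′)) avoids
  ... | none = ∨-conicalˡ _ _ none , ∨-conicalʳ _ _ none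
  ys-max : isDumont ys ≡ true × isEven (suc n) ≡ (0 <ᵇ b)
  ys-max = isDumont-max⁻ (suc n) ys ys<n (∧-conicalʳ _ _ dumont-parts)
  prefix : n ∸ b ≡ 0 ⊎ isEven b ≡ true
  prefix = prefix-parity b (n ∸ b) α↭ α′<n dumont
  admissible : Admissible n b
  admissible = record { b≤n = b≤n ; prefix = prefix ; max-parity = proj₂ ys-max }
  α-dumont : isDumont α ≡ true
  α-dumont = trans (sym (isDumont-shift-prefix prefix α↭)) (∧-conicalˡ _ _ dumont-parts)
  α-avoids : contains132 α ≡ false
  α-avoids = trans (sym (contains132-shift b α)) (proj₁ avoids-parts)

glue-good : ∀ {n b α β} → Admissible n b → GoodPerm (n ∸ b) α → GoodPerm b β → GoodPerm (suc n) (glue b (suc n) α β)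
glue-good {n} {b} {α} {β} adm (goodPerm α↭ α-dumont α-avoids) (goodPerm β↭ β-dumont β-avoids)
  with glue-bounds (Admissible.b≤n adm) α↭ β↭
... | α′<n , β<n , β<α′ = goodPerm (glue-↭ (m+[n∸m]≡n b≤n) α↭ β↭) dumont avoids
  where
  open Admissible adm
  dumont : isDumont (glue b (suc n) α β) ≡ true
  dumont = trans (isDumont-++-∷ (map (b +_) α) (suc n) β α′<n)
                 (cong₂ _∧_ (trans (isDumont-shift-prefix prefix α↭) α-dumont)
                            (isDumont-max⁺ (suc n) β β<n β-dumont
                              (trans max-parity (cong (0 <ᵇ_) (sym (length-↭-oneTo β↭))))))
  avoids : contains132 (glue b (suc n) α β) ≡ false
  avoids = trans (contains132-++-∷ (map (b +_) α) (suc n) β α′<n β<n β<α′)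
                 (cong₂ _∨_ (trans (contains132-shift b α) α-avoids) β-avoids)

rlMaxCount-glue : ∀ {n b α β} → b ≤ n → α ∈ Good (n ∸ b) → β ∈ Good b → rlMaxCount (glue b (suc n) α β) ≡ suc (rlMaxCount β)
rlMaxCount-glue {n} {b} {α} {β} b≤n α∈ β∈
  with glue-bounds b≤n (GoodPerm.perm (∈-Good⇔ .to α∈)) (GoodPerm.perm (∈-Good⇔ .to β∈))
... | α′<n , β<n , _ = rlMaxCount-++-∷ (map (b +_) α) (suc n) β α′<n β<n

GluedWith : ℕ → ℕ → List ℕ → List (List ℕ)
GluedWith n b α = map (glue b (suc n) α) (Good b)

GluedOfSize : ℕ → ℕ → List (List ℕ)
GluedOfSize n b = concatMap (GluedWith n b) (Good (n ∸ b))

Glued : ℕ → List ℕ → List (List ℕ)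
Glued n bs = concatMap (GluedOfSize n) bs

∈-Glued⁺ : ∀ {n bs b α β} → b ∈ bs → α ∈ Good (n ∸ b) → β ∈ Good b → glue b (suc n) α β ∈ Glued n bs
∈-Glued⁺ {n} {b = b} {α} b∈ α∈ β∈ =
  ∈-concatMap-intro (GluedOfSize n) b∈ (∈-concatMap-intro (GluedWith n b) α∈ (∈-map⁺ (glue b (suc n) α) β∈))

∈-GluedOfSize⁻ : ∀ {n b π} → π ∈ GluedOfSize n b → ∃₂ λ α β → α ∈ Good (n ∸ b) × β ∈ Good b × π ≡ glue b (suc n) α β
∈-GluedOfSize⁻ {n} {b} π∈ with ∈-concatMap-find (GluedWith n b) (Good (n ∸ b)) π∈
... | α , α∈ , π∈′ with ∈-map⁻ (glue b (suc n) α) π∈′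
... | β , β∈ , refl = α , β , α∈ , β∈ , refl

∈-Glued⁻ : ∀ {n bs π} → π ∈ Glued n bs
  → ∃ λ b → ∃₂ λ α β → b ∈ bs × α ∈ Good (n ∸ b) × β ∈ Good b × π ≡ glue b (suc n) α β
∈-Glued⁻ {n} {bs} π∈ with ∈-concatMap-find (GluedOfSize n) bs π∈
... | b , b∈ , π∈′ with ∈-GluedOfSize⁻ {n} {b} π∈′
... | α , β , α∈ , β∈ , eq = b , α , β , b∈ , α∈ , β∈ , eq

max∉prefix : ∀ {n b α} → b ≤ n → α ∈ Good (n ∸ b) → suc n ∉ map (b +_) α
max∉prefix {n} b≤n α∈ n∈ =
  <⇒≱ ≤-refl (subst (suc n ≤_) (m+[n∸m]≡n b≤n) (proj₂ (∈-shifted-↭-oneTo (GoodPerm.perm (∈-Good⇔ .to α∈)) n∈)))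

Unique-Glued : ∀ {n bs} → Unique bs → (∀ {b} → b ∈ bs → b ≤ n) → Unique (Glued n bs)
Unique-Glued {n} {bs} !bs b≤n = Unique-concatMap (GluedOfSize n) !bs (λ b∈ → Unique-GluedOfSize (b≤n b∈)) sameSize
  where
  Unique-GluedOfSize : ∀ {b} → b ≤ n → Unique (GluedOfSize n b)
  Unique-GluedOfSize {b} b≤n′ =
    Unique-concatMap (GluedWith n b) (Unique-Good (n ∸ b))
      (λ {α} _ → Unique.map⁺ (λ eq → List.∷-injectiveʳ (List.++-cancelˡ (map (b +_) α) _ _ eq)) (Unique-Good b))
      samePrefix
    where
    samePrefix : ∀ {α α′ π} → α ∈ Good (n ∸ b) → α′ ∈ Good (n ∸ b) → π ∈ GluedWith n b α → π ∈ GluedWith n b α′ → α ≡ α′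
    samePrefix {α} {α′} α∈ α′∈ π∈ π∈′ with ∈-map⁻ (glue b (suc n) α) π∈ | ∈-map⁻ (glue b (suc n) α′) π∈′
    ... | β , _ , refl | β′ , _ , eq = List.map-injective (+-cancelˡ-≡ b _ _)
      (proj₁ (++-∷-injective (map (b +_) α) (map (b +_) α′) (max∉prefix b≤n′ α∈) (max∉prefix b≤n′ α′∈) eq))
  sameSize : ∀ {b b′ π} → b ∈ bs → b′ ∈ bs → π ∈ GluedOfSize n b → π ∈ GluedOfSize n b′ → b ≡ b′
  sameSize {b} {b′} b∈ b′∈ π∈ π∈′ with ∈-GluedOfSize⁻ {n} {b} π∈ | ∈-GluedOfSize⁻ {n} {b′} π∈′
  ... | α , β , α∈ , β∈ , refl | α′ , β′ , α′∈ , β′∈ , eq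
    with ++-∷-injective (map (b +_) α) (map (b′ +_) α′) (max∉prefix (b≤n b∈) α∈) (max∉prefix (b≤n b′∈) α′∈) eq
  ... | _ , refl = trans (sym (length-↭-oneTo (GoodPerm.perm (∈-Good⇔ .to β∈))))
                         (length-↭-oneTo (GoodPerm.perm (∈-Good⇔ .to β′∈)))

record AdmissibleSizes (n : ℕ) (bs : List ℕ) : Set where
  field
    unique   : Unique bs
    sound    : ∀ {b} → b ∈ bs → Admissible n b
    complete : ∀ {b} → Admissible n b → b ∈ bs

Good-suc↭Glued : ∀ {n bs} → AdmissibleSizes n bs → Good (suc n) ↭ Glued n bs
Good-suc↭Glued {n} {bs} sizes =
  ∼bag⇒↭ (unique∧set⇒bag (Unique-Good (suc n)) (Unique-Glued unique (λ b∈ → Admissible.b≤n (sound b∈))) (mk⇔ split join))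
  where
  open AdmissibleSizes sizes
  split : ∀ {π} → π ∈ Good (suc n) → π ∈ Glued n bs
  split {π} π∈ with ∈-Good⇔ .to π∈
  ... | good with ∈-∃++ (∈-resp-↭ (↭-sym (GoodPerm.perm good)) (∈-oneTo⁺ {suc n} {suc n} (s≤s z≤n) ≤-refl))
  ... | xs , ys , refl with good-split xs ys good
  ... | α , refl , adm , α-good , ys-good = ∈-Glued⁺ (complete adm) (∈-Good⇔ .from α-good) (∈-Good⇔ .from ys-good)
  join : ∀ {π} → π ∈ Glued n bs → π ∈ Good (suc n)
  join π∈ with ∈-Glued⁻ {n} {bs} π∈
  ... | b , α , β , b∈ , α∈ , β∈ , refl = ∈-Good⇔ .from (glue-good (sound b∈) (∈-Good⇔ .to α∈) (∈-Good⇔ .to β∈))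

-- Counting

total : ℕ → ℕ
total n = length (Good n)

rlCount : (ℕ → Bool) → ℕ → ℕ
rlCount f n = length (filter (λ π → T? (f (rlMaxCount π))) (Good n))

rlCount-true : ∀ n → rlCount (λ _ → true) n ≡ total n
rlCount-true n = cong length (List.filter-all (λ π → T? true) (All.universal _ (Good n)))

rlCount-Glued : ∀ n bs f → (∀ {b} → b ∈ bs → b ≤ n)
  → length (filter (λ π → T? (f (rlMaxCount π))) (Glued n bs))
    ≡ sum (map (λ b → total (n ∸ b) * rlCount (λ k → f (suc k)) b) bs)
rlCount-Glued n bs f b≤n =
  trans (length-filter-concatMap P (GluedOfSize n) bs)
        (sum-map-cong bs (λ {b} b∈ → trans (length-filter-concatMap P (GluedWith n b) (Good (n ∸ b))) (per-size b∈)))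
  where
  P : List ℕ → Bool
  P π = f (rlMaxCount π)
  per-size : ∀ {b} → b ∈ bs
    → sum (map (λ α → length (filter (λ π → T? (P π)) (GluedWith n b α))) (Good (n ∸ b)))
      ≡ total (n ∸ b) * rlCount (λ k → f (suc k)) b
  per-size {b} b∈ = sum-map-const _ (Good (n ∸ b)) _
    (λ {α} α∈ → length-filter-map P (λ β → f (suc (rlMaxCount β))) (glue b (suc n) α) (Good b)
                  (λ β∈ → cong f (rlMaxCount-glue (b≤n b∈) α∈ β∈)))

rlCount-suc : ∀ {n bs} → AdmissibleSizes n bs → ∀ f
  → rlCount f (suc n) ≡ sum (map (λ b → total (n ∸ b) * rlCount (λ k → f (suc k)) b) bs)
rlCount-suc {n} {bs} sizes f =
  trans (↭-length (filter-↭ (λ π → T? (f (rlMaxCount π))) (Good-suc↭Glued sizes)))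
        (rlCount-Glued n bs f (λ b∈ → Admissible.b≤n (AdmissibleSizes.sound sizes b∈)))

admissible-double : ∀ m → AdmissibleSizes (m + m) [ 0 ]
admissible-double m = record
  { unique   = [] ∷ []
  ; sound    = λ { (here refl) → record { b≤n = z≤n ; prefix = inj₂ refl ; max-parity = isEven-suc-double m } }
  ; complete = complete
  }
  where
  complete : ∀ {b} → Admissible (m + m) b → b ∈ [ 0 ]
  complete {zero}  _   = here refl
  complete {suc b} adm = ⊥-elim (false≢true (trans (sym (isEven-suc-double m)) (Admissible.max-parity adm)))

-- For the maximum 2m + 2 the admissible sizes are 2m + 1 and the even sizes
-- evenSize m i = 2(m − i), i < m, which leave a prefix of length 2i + 1.
evenSize : ℕ → ℕ → ℕ
evenSize m i = (m ∸ i) + (m ∸ i)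

evenSizes : ℕ → List ℕ
evenSizes m = applyUpTo (evenSize m) m ++ [ suc (m + m) ]

admissible-suc-double : ∀ m → AdmissibleSizes (suc (m + m)) (evenSizes m)
admissible-suc-double m = record
  { unique   = Unique.++⁺ (Unique.applyUpTo⁺₁ d m d-injective) ([] ∷ []) d≢last
  ; sound    = sound
  ; complete = complete
  }
  where
  d = evenSize m
  n = suc (m + m)
  d-injective : ∀ {i j} → i < j → j < m → d i ≢ d j
  d-injective i<j j<m eq = <⇒≢ (+-mono-< m∸j<m∸i m∸j<m∸i) (sym eq)
    where m∸j<m∸i = ∸-monoʳ-< i<j (<⇒≤ j<m)
  d≢last : ∀ {v} → v ∈ applyUpTo d m × v ∈ [ n ] → ⊥
  d≢last (v∈ , here refl) with ∈-applyUpTo⁻ d v∈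
  ... | i , _ , eq = false≢true (trans (sym (isEven-suc-double m)) (trans (cong isEven eq) (isEven-double (m ∸ i))))
  sound : ∀ {b} → b ∈ evenSizes m → Admissible n b
  sound b∈ with ∈-++⁻ (applyUpTo d m) b∈
  ... | inj₂ (here refl) = record { b≤n = ≤-refl ; prefix = inj₁ (n∸n≡0 n) ; max-parity = isEven-double m }
  ... | inj₁ b∈d with ∈-applyUpTo⁻ d b∈d
  ...   | i , i<m , refl = record
          { b≤n        = m≤n⇒m≤1+n (+-mono-≤ (m∸n≤m m i) (m∸n≤m m i))
          ; prefix     = inj₂ (isEven-double (m ∸ i))
          ; max-parity = trans (isEven-double m) (sym (<⇒<ᵇ≡true (+-mono-≤ (m<n⇒0<n∸m i<m) z≤n)))
          }
  complete : ∀ {b} → Admissible n b → b ∈ evenSizes m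
  complete {zero} adm = ⊥-elim (false≢true (trans (sym (Admissible.max-parity adm)) (isEven-double m)))
  complete {suc b} record { b≤n = b≤n ; prefix = inj₁ n∸b≡0 } rewrite ≤-antisym b≤n (m∸n≡0⇒m≤n n∸b≡0) =
    ∈-++⁺ʳ (applyUpTo d m) (here refl)
  complete {suc b} record { b≤n = b≤n ; prefix = inj₂ ev } with isEven⇒double {suc b} ev
  ... | zero    , ()
  ... | suc j , eq =
    ∈-++⁺ˡ (subst (_∈ applyUpTo d m) (trans d≡ (sym eq)) (∈-applyUpTo⁺ d (∸-monoʳ-< {m} {suc j} {0} (s≤s z≤n) j<m)))
    where
    j<m : suc j ≤ m
    j<m = ≰⇒> λ m≤j → <-irrefl refl
      (<-≤-trans (subst (n <_) (sym (double-suc m)) ≤-refl)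
                 (≤-trans (+-mono-≤ (s≤s m≤j) (s≤s m≤j)) (subst (_≤ n) eq b≤n)))
    d≡ : d (m ∸ suc j) ≡ suc j + suc j
    d≡ = cong (λ t → t + t) (m∸[m∸n]≡n j<m)

rlCount-odd : ∀ m f → rlCount f (suc (m + m)) ≡ total (m + m) * rlCount (λ k → f (suc k)) 0
rlCount-odd m f = trans (rlCount-suc (admissible-double m) f) (+-identityʳ _)

∸-evenSize : ∀ {i m} → i ≤ m → suc (m + m) ∸ evenSize m i ≡ suc (i + i)
∸-evenSize {i} {m} i≤m = begin
  suc (m + m) ∸ (d + d)                      ≡⟨ cong (λ t → suc (t + t) ∸ (d + d)) (m+[n∸m]≡n i≤m) ⟨
  suc ((i + d) + (i + d)) ∸ (d + d)          ≡⟨ cong (_∸ (d + d)) (regroup i d) ⟩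
  (suc (i + i) + (d + d)) ∸ (d + d)          ≡⟨ m+n∸n≡m (suc (i + i)) (d + d) ⟩
  suc (i + i)                                ∎
  where
  d = m ∸ i
  regroup : ∀ i d → suc ((i + d) + (i + d)) ≡ suc (i + i) + (d + d)
  regroup = solve-∀

-- Adding the missing term i = m (which has b = 0) completes the sum over the
-- admissible even sizes to a Cauchy product.
rlCount-even : ∀ m f
  → rlCount f (suc (suc (m + m))) + total (suc (m + m)) * rlCount (λ k → f (suc k)) 0
  ≡ ((λ i → total (suc (i + i))) · (λ j → rlCount (λ k → f (suc k)) (j + j))) m + rlCount (λ k → f (suc k)) (suc (m + m))
rlCount-even m f = begin
  rlCount f (suc n) + total n * rlCount g 0
    ≡⟨ cong (λ j → rlCount f (suc n) + G (j + j)) (n∸n≡0 m) ⟨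
  rlCount f (suc n) + G (d m)
    ≡⟨ cong (_+ G (d m)) (rlCount-suc (admissible-suc-double m) f) ⟩
  sum (map G (applyUpTo d m ++ [ n ])) + G (d m)
    ≡⟨ cong (_+ G (d m)) (trans (cong sum (List.map-++ G (applyUpTo d m) [ n ])) (sum-++ (map G (applyUpTo d m)) [ G n ])) ⟩
  sum (map G (applyUpTo d m)) + (G n + 0) + G (d m)
    ≡⟨ cong (λ s → s + (G n + 0) + G (d m)) (cong sum (List.map-applyUpTo d G m)) ⟩
  sum (applyUpTo (λ i → G (d i)) m) + (G n + 0) + G (d m)
    ≡⟨ swap-last (sum (applyUpTo (λ i → G (d i)) m)) (G n) (G (d m)) ⟩
  (sum (applyUpTo (λ i → G (d i)) m) + G (d m)) + G n
    ≡⟨ cong₂ _+_ (sum-applyUpTo-+ m (λ i → G (d i)))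
                 (trans (cong (λ t → total t * rlCount g n) (n∸n≡0 n)) (*-identityˡ (rlCount g n))) ⟩
  sumTo m (λ i → G (d i)) + rlCount g n
    ≡⟨ cong (_+ rlCount g n) (sumTo-cong m (λ i i≤m → cong (λ t → total t * rlCount g (d i)) (∸-evenSize i≤m))) ⟩
  sumTo m (λ i → total (suc (i + i)) * rlCount g (d i)) + rlCount g n ∎
  where
  n = suc (m + m)
  g : ℕ → Bool
  g k = f (suc k)
  d = evenSize m
  G : ℕ → ℕ
  G b = total (n ∸ b) * rlCount g b
  swap-last : ∀ a b c → a + (b + 0) + c ≡ (a + c) + b
  swap-last = solve-∀

-- The series R k

r≡rlCount : ∀ n k → r n k ≡ rlCount (_≡ᵇ k) n
r≡rlCount n k = cong length (begin
  filter (λ π → T? (isDumont π ∧ (avoids132 π ∧ rl≡k π))) (Sym n)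
    ≡⟨ filter-∧ isDumont (λ π → avoids132 π ∧ rl≡k π) (Sym n) ⟩
  filter (λ π → T? (avoids132 π ∧ rl≡k π)) (filter (λ π → T? (isDumont π)) (Sym n))
    ≡⟨ filter-∧ avoids132 rl≡k (filter (λ π → T? (isDumont π)) (Sym n)) ⟩
  filter (λ π → T? (rl≡k π)) (filter (λ π → T? (avoids132 π)) (filter (λ π → T? (isDumont π)) (Sym n)))
    ≡⟨ cong (filter (λ π → T? (rl≡k π))) (filter-∧ isDumont avoids132 (Sym n)) ⟨
  filter (λ π → T? (rl≡k π)) (Good n) ∎)
  where
  rl≡k : List ℕ → Bool
  rl≡k π = rlMaxCount π ≡ᵇ k

-- The last entry is always a right-to-left maximum.
r-suc-zero : ∀ n → r (suc n) 0 ≡ 0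
r-suc-zero n =
  trans (r≡rlCount (suc n) 0) (cong length (List.filter-none (λ π → T? (rlMaxCount π ≡ᵇ 0)) (All.tabulate no-maximum)))
  where
  no-maximum : ∀ {π} → π ∈ Good (suc n) → ¬ T (rlMaxCount π ≡ᵇ 0)
  no-maximum {[]}    π∈ _ with () ← length-↭-oneTo (GoodPerm.perm (∈-Good⇔ {suc n} .to π∈))
  no-maximum {x ∷ π} _  t = rlMaxCount-∷ x π (≡ᵇ⇒≡ _ 0 t)

total-odd : ∀ m → total (suc (m + m)) ≡ total (m + m)
total-odd m = begin
  total (suc (m + m))                          ≡⟨ rlCount-true (suc (m + m)) ⟨
  rlCount (λ _ → true) (suc (m + m))           ≡⟨ rlCount-odd m (λ _ → true) ⟩
  total (m + m) * 1                            ≡⟨ *-identityʳ (total (m + m)) ⟩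
  total (m + m)                                ∎

total-double-suc : ∀ m → total (suc m + suc m) ≡ ((λ j → total (j + j)) · (λ j → total (j + j))) m
total-double-suc m = +-cancelʳ-≡ (E m) _ _ (begin
  total (suc m + suc m) + E m
    ≡⟨ cong₂ _+_ (trans (cong total (double-suc m)) (sym (rlCount-true (suc (suc (m + m))))))
                 (sym (trans (cong (_* 1) (total-odd m)) (*-identityʳ (E m)))) ⟩
  rlCount always (suc (suc (m + m))) + total (suc (m + m)) * rlCount always 0
    ≡⟨ rlCount-even m (λ _ → true) ⟩
  ((λ i → total (suc (i + i))) · (λ j → rlCount always (j + j))) m + rlCount always (suc (m + m))
    ≡⟨ cong₂ _+_ (sumTo-cong m (λ i _ → cong₂ _*_ (total-odd i) (rlCount-true (m ∸ i + (m ∸ i)))))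
                 (trans (rlCount-true (suc (m + m))) (total-odd m)) ⟩
  (E · E) m + E m ∎)
  where
  always : ℕ → Bool
  always _ = true
  E : ℕ → ℕ
  E j = total (j + j)

total-double : ∀ m → total (m + m) ≡ Cat m
total-double = Catalan-unique (λ j → total (j + j)) refl total-double-suc

total-suc-double : ∀ m → total (suc (m + m)) ≡ Cat m
total-suc-double m = trans (total-odd m) (total-double m)

r-odd : ∀ m k → r (suc (m + m)) (suc k) ≡ Cat m * r 0 k
r-odd m k = begin
  r (suc (m + m)) (suc k)               ≡⟨ r≡rlCount (suc (m + m)) (suc k) ⟩
  rlCount (_≡ᵇ suc k) (suc (m + m))     ≡⟨ rlCount-odd m (_≡ᵇ suc k) ⟩
  total (m + m) * rlCount (_≡ᵇ k) 0     ≡⟨ cong₂ _*_ (total-double m) (sym (r≡rlCount 0 k)) ⟩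
  Cat m * r 0 k                         ∎

r-even : ∀ m k
  → r (suc (suc (m + m))) (suc k) + Cat m * r 0 k ≡ (Cat · (λ j → r (j + j) k)) m + r (suc (m + m)) k
r-even m k = begin
  r (suc (suc (m + m))) (suc k) + Cat m * r 0 k
    ≡⟨ cong₂ _+_ (r≡rlCount (suc (suc (m + m))) (suc k)) (cong₂ _*_ (sym (total-suc-double m)) (r≡rlCount 0 k)) ⟩
  rlCount (_≡ᵇ suc k) (suc (suc (m + m))) + total (suc (m + m)) * rlCount (_≡ᵇ k) 0
    ≡⟨ rlCount-even m (_≡ᵇ suc k) ⟩
  ((λ i → total (suc (i + i))) · (λ j → rlCount (_≡ᵇ k) (j + j))) m + rlCount (_≡ᵇ k) (suc (m + m))
    ≡⟨ cong₂ _+_ (sumTo-cong m (λ i _ → cong₂ _*_ (total-suc-double i) (sym (r≡rlCount (m ∸ i + (m ∸ i)) k))))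
                 (sym (r≡rlCount (suc (m + m)) k)) ⟩
  (Cat · (λ j → r (j + j) k)) m + r (suc (m + m)) k ∎

r-double-zero : ∀ m → r (m + m) 0 ≡ one m
r-double-zero zero    = refl
r-double-zero (suc m) = trans (cong (λ n → r n 0) (double-suc m)) (r-suc-zero (suc (m + m)))

r-double-one : ∀ m → r (m + m) 1 ≡ 0
r-double-one zero    = refl
r-double-one (suc m) = +-cancelʳ-≡ (Cat m) _ _ (begin
  r (suc m + suc m) 1 + Cat m
    ≡⟨ cong₂ _+_ (cong (λ n → r n 1) (double-suc m)) (sym (*-identityʳ (Cat m))) ⟩
  r (suc (suc (m + m))) 1 + Cat m * 1
    ≡⟨ r-even m 0 ⟩
  (Cat · (λ j → r (j + j) 0)) m + r (suc (m + m)) 0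
    ≡⟨ cong₂ _+_ (sumTo-cong m (λ i _ → cong (Cat i *_) (r-double-zero (m ∸ i)))) (r-suc-zero (m + m)) ⟩
  (Cat · one) m + 0
    ≡⟨ trans (+-identityʳ _) (·-identityʳ Cat m) ⟩
  Cat m ∎)

r-even-suc : ∀ m k
  → r (suc (suc (m + m))) (suc (suc k)) ≡ (Cat · (λ j → r (j + j) (suc k))) m + r (suc (m + m)) (suc k)
r-even-suc m k = begin
  r (suc (suc (m + m))) (suc (suc k))                ≡⟨ +-identityʳ _ ⟨
  r (suc (suc (m + m))) (suc (suc k)) + 0            ≡⟨ cong (r (suc (suc (m + m))) (suc (suc k)) +_) (*-zeroʳ (Cat m)) ⟨
  r (suc (suc (m + m))) (suc (suc k)) + Cat m * 0    ≡⟨ r-even m (suc k) ⟩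
  (Cat · (λ j → r (j + j) (suc k))) m + r (suc (m + m)) (suc k) ∎

r-double-from-two : ∀ j m → r (m + m) (suc (suc j)) ≡ xPow· (suc j) (Cat ^^ suc j) m
r-double-from-two j       zero    = refl
r-double-from-two zero    (suc m) = begin
  r (suc m + suc m) 2                                  ≡⟨ cong (λ n → r n 2) (double-suc m) ⟩
  r (suc (suc (m + m))) 2                              ≡⟨ r-even-suc m 0 ⟩
  (Cat · (λ i → r (i + i) 1)) m + r (suc (m + m)) 1
    ≡⟨ cong₂ _+_ (trans (sumTo-cong m (λ i _ → cong (Cat i *_) (r-double-one (m ∸ i)))) (·-zeroʳ Cat m)) (r-odd m 0) ⟩
  Cat m * 1                                            ≡⟨ *-identityʳ (Cat m) ⟩
  Cat m                                                ≡⟨ ·-identityʳ Cat m ⟨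
  (Cat · one) m                                        ∎
r-double-from-two (suc j) (suc m) = begin
  r (suc m + suc m) (3 + j)                            ≡⟨ cong (λ n → r n (3 + j)) (double-suc m) ⟩
  r (suc (suc (m + m))) (3 + j)                        ≡⟨ r-even-suc m (suc j) ⟩
  (Cat · (λ i → r (i + i) (2 + j))) m + r (suc (m + m)) (2 + j)
    ≡⟨ cong₂ _+_ (sumTo-cong m (λ i _ → cong (Cat i *_) (r-double-from-two j (m ∸ i))))
                 (trans (r-odd m (suc j)) (*-zeroʳ (Cat m))) ⟩
  (Cat · xPow· (suc j) (Cat ^^ suc j)) m + 0           ≡⟨ +-identityʳ _ ⟩
  (Cat · xPow· (suc j) (Cat ^^ suc j)) m               ≡⟨ ·-xPow· (suc j) Cat (Cat ^^ suc j) m ⟩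
  xPow· (suc j) (Cat ^^ suc (suc j)) m                 ≡⟨ xPow·-suc (suc j) (Cat ^^ suc (suc j)) m ⟨
  xPow· (suc (suc j)) (Cat ^^ suc (suc j)) (suc m)     ∎

2*[2+j]∸2 : ∀ j → 2 * suc (suc j) ∸ 2 ≡ suc j + suc j
2*[2+j]∸2 j = cong (_∸ 2) (double j)
  where
  double : ∀ j → 2 * suc (suc j) ≡ 2 + (suc j + suc j)
  double = solve-∀

R-from-two : ∀ k → 2 ≤ k → ∀ n → R k n ≡ xPow· (2 * k ∸ 2) (subSq (Cat ^^ (k ∸ 1))) n
R-from-two (suc zero)    (s≤s ())
R-from-two (suc (suc j)) _ n rewrite 2*[2+j]∸2 j with evenOrOdd n
... | even m = trans (r-double-from-two j m) (sym (xPow·-subSq-double (suc j) (Cat ^^ suc j) m))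
... | odd m  = trans (trans (r-odd m (suc j)) (*-zeroʳ (Cat m)))
                    (sym (xPow·-subSq-suc-double (suc j) (Cat ^^ suc j) m))

R-below-two : ∀ k → k ≤ 1 → ∀ n → R k n ≡ xPow· k (subSq (Cat ^^ k)) n
R-below-two zero          _         n with evenOrOdd n
... | even m = trans (r-double-zero m) (sym (subSq-double one m))
... | odd m  = trans (r-suc-zero (m + m)) (sym (subSq-suc-double one m))
R-below-two (suc zero)    _         zero = refl
R-below-two (suc zero)    _         (suc n) with evenOrOdd n
... | even m = trans (trans (r-odd m 0) (*-identityʳ (Cat m)))
                    (sym (trans (subSq-double (Cat · one) m) (·-identityʳ Cat m)))
... | odd m  = trans (trans (cong (λ n → r n 1) (sym (double-suc m))) (r-double-one (suc m)))
                    (sym (subSq-suc-double (Cat · one) m))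
R-below-two (suc (suc k)) (s≤s ())

corollary2p7 :
    ((k : ℕ) → 2 ≤ k → (n : ℕ) →
       R k n ≡ xPow· (2 * k ∸ 2) (subSq (Cat ^^ (k ∸ 1))) n)
    ×
    ((k : ℕ) → k ≤ 1 → (n : ℕ) →
       R k n ≡ xPow· k (subSq (Cat ^^ k)) n)
corollary2p7 = R-from-two , R-below-two
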